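{- Let $d$ and $m$ be positive integers and let $$\mathcal{S}_d(m)=\begin{cases}[0,m]\subset\mathbb{R} & \text{if } d=1,\\ \mathrm{conv}\{\mathbf{0},\mathbf{e}_1,\ldots,\mathbf{e}_{d-1},(q_1(d),\ldots,q_{d-1}(d),d!\cdot m)\}\subset\mathbb{R}^d & \text{if } d\geq 2,\end{cases}$$ where $\mathbf{e}_i$ is the $i$-th unit coordinate vector of $\mathbb{R}^d$, $\mathbf{0}$ is the origin, and $q_i(d)=\dfrac{ -d!}{i!+(i-1)!}$ for $1\leq i\leq d-1$. Then the Ehrhart polynomial of $\mathcal{S}_d(m)$ is $$i(\mathcal{S}_d(m),t)=mt^d+\sum_{i=0}^{d-1}\binom{d}{i}t^i.$$ In particular, all coefficients of $i(\mathcal{S}_d(m),t)$ are nonnegative.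
   Context: For a $d$-dimensional integral polytope $\mathcal{P}\subset\mathbb{R}^d$, the Ehrhart polynomial $i(\mathcal{P},t)$ is the polynomial with $i(\mathcal{P},t)=\#(t\mathcal{P}\cap\mathbb{Z}^d)$ for all positive integers $t$. -}

module Defs where

open import Data.Nat as ℕ using (ℕ; zero; suc; _+_; _∸_; _!; NonZero)
open import Data.Nat.Properties using (1≤n!; m≤m+n; ≤-trans)
open import Data.Nat.DivMod using (_/_)
open import Data.Integer as ℤ using (ℤ; +_; -_)
open import Data.Rational as ℚ using (ℚ; 0ℚ; 1ℚ)
open import Data.Fin as Fin using (Fin; inject₁)
open import Data.Vec as Vec using (Vec; []; _∷_; _∷ʳ_; tabulate; lookup; zipWith; foldr)
open import Data.Vec.Relation.Unary.All using (All)
open import Data.List as List using (List; length)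
open import Data.List.Membership.Propositional using (_∈_)
open import Data.List.Relation.Unary.Unique.Propositional using (Unique)
open import Data.Product using (Σ; _×_)
open import Function.Bundles using (_⇔_)
open import Relation.Nullary using (does)
open import Relation.Binary.PropositionalEquality using (_≡_)
open import Data.Bool using (if_then_else_)

denom-nonZero : (i : ℕ) → NonZero (i ! + (i ∸ 1) !)
denom-nonZero i = ℕ.>-nonZero (≤-trans (1≤n! i) (m≤m+n (i !) ((i ∸ 1) !)))

-- q_i(d) = - d! / (i! + (i-1)!)   (an integer for 1 ≤ i ≤ d-1)
q : (i d : ℕ) → ℤ
q i d = - (+ (_/_ (d !) (i ! + (i ∸ 1) !) {{denom-nonZero i}}))

⟦_⟧ : ℤ → ℚ
⟦ z ⟧ = z ℚ./ 1

sumℚ : {k : ℕ} → Vec ℚ k → ℚ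
sumℚ = foldr _ ℚ._+_ 0ℚ

origin : (d : ℕ) → Vec ℤ d
origin d = tabulate (λ _ → + 0)

-- unit vector e_{i+1} of ℤ^(n+2), for i : Fin (n+1) (0-based index i)
unit : (n : ℕ) → Fin (suc n) → Vec ℤ (suc (suc n))
unit n i = tabulate (λ c → if does (c Fin.≟ inject₁ i) then + 1 else + 0)

apex : (n m : ℕ) → Vec ℤ (suc (suc n))
apex n m = tabulate (λ (j : Fin (suc n)) → q (suc (Fin.toℕ j)) (suc (suc n)))
           ∷ʳ (+ (suc (suc n) ! ℕ.* m))

-- the d+1 vertices of S_d(m)
-- d = 1 : {0, m} (so conv = [0,m]);  d ≥ 2 : 0, e_1,…,e_{d-1}, apex
vertices : (d m : ℕ) → Vec (Vec ℤ d) (suc d)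
vertices zero m = [] ∷ []
vertices (suc zero) m = (+ 0 ∷ []) ∷ (+ m ∷ []) ∷ []
vertices (suc (suc n)) m =
  origin (suc (suc n)) ∷ (tabulate (unit n) ∷ʳ apex n m)

InDilatedHull : {d k : ℕ} → ℕ → Vec (Vec ℤ d) k → Vec ℤ d → Set
InDilatedHull {d} {k} t V x =
  Σ (Vec ℚ k) λ lam →
    All (0ℚ ℚ.≤_) lam × sumℚ lam ≡ 1ℚ ×
    ((c : Fin d) → ⟦ lookup x c ⟧ ≡
        ⟦ + t ⟧ ℚ.* sumℚ (zipWith (λ l v → l ℚ.* ⟦ lookup v c ⟧) lam V))

HasExactly : {d : ℕ} → (Vec ℤ d → Set) → ℕ → Set
HasExactly {d} P n =
  Σ (List (Vec ℤ d)) λ xs → Unique xs × ((x : Vec ℤ d) → (x ∈ xs ⇔ P x)) × length xs ≡ n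

latticeCount≡ : (d m t N : ℕ) → Set
latticeCount≡ d m t N = HasExactly (InDilatedHull t (vertices d m)) N

Σ< : ℕ → (ℕ → ℕ) → ℕ
Σ< zero f = 0
Σ< (suc k) f = Σ< k f + f k

-- Write a point of ℤ^d as (y, k) with y ∈ ℤ^(d-1). Solving for barycentric coordinates shows that
-- (y, k) ∈ t·S_d(m) iff k ≥ 0, m κⱼ yⱼ + k ≥ 0 with κⱼ = (j+1)! + j!, and m (Σ y) + k ≤ m t: the integers
-- ρⱼ = d!/κⱼ = -q_(j+1)(d) satisfy Σ ρⱼ + 1 = d!, and weighting the facets by ρⱼ gives d! (Σ y + k) ≥ k.
-- Writing k = K m + r with 0 ≤ r < m reduces the count to m = 1 at level t (r = 0) or t - 1 (r > 0),
-- so it suffices that the count for m = 1 is (t+1)^d; then (t+1)^d + (m-1) t^d is the claimed polynomial.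
-- For m = 1, group the points by the digits k / (d-1)! = A d + a with 0 ≤ a < d: those of level
-- Σ y + k ≤ v + A number v^a (v+1)^(d-1-a). Dropping the last coordinate gives a recursion in d for these
-- counts, because the facet of that coordinate only involves A and the two leading digits of k, and
-- summing over the blocks telescopes to (t+1)^d.
module Submission where

module Enumerations where

  open import Data.Nat using (ℕ; zero; suc; _+_; _<_; s≤s)
  open import Data.Nat.Properties using (m<n⇒m<1+n; ≤-refl; <-irrefl; m≤n⇒m<n∨m≡n)
  open import Data.Fin using (Fin; _↑ˡ_; _↑ʳ_; splitAt; join)
  open import Data.Fin.Properties using (splitAt-↑ˡ; splitAt-↑ʳ; join-splitAt)
  open import Data.Sum using (_⊎_; inj₁; inj₂; [_,_])
  open import Data.Product using (_×_; _,_; ∃-syntax)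
  open import Data.Empty using (⊥; ⊥-elim)
  open import Data.List using (tabulate)
  open import Data.List.Membership.Propositional using (_∈_)
  open import Data.List.Membership.Propositional.Properties using (∈-tabulate⁺; ∈-tabulate⁻)
  open import Data.List.Relation.Unary.Unique.Propositional.Properties using (tabulate⁺)
  open import Data.List.Properties using (length-tabulate)
  open import Data.Vec using (Vec)
  open import Data.Integer using (ℤ)
  open import Function.Bundles using (mk⇔)
  open import Function.Definitions using (Injective)
  open import Relation.Binary.PropositionalEquality using (_≡_; refl; sym; trans; cong; subst; module ≡-Reasoning)
  open import Defs using (HasExactly; Σ<)

  record Enumeration {A : Set} (P : A → Set) (c : ℕ) : Set where
    field
      element   : Fin c → A
      injective : Injective _≡_ _≡_ element
      sound     : ∀ i → P (element i)
      complete  : ∀ {x} → P x → ∃[ i ] element i ≡ x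

  open Enumeration

  Image : {A B : Set} → (A → B) → (A → Set) → B → Set
  Image f P y = ∃[ x ] P x × f x ≡ y

  ⋃< : {A : Set} → ℕ → (ℕ → A → Set) → A → Set
  ⋃< K Q x = ∃[ i ] i < K × Q i x

  hasExactly : ∀ {d} {P : Vec ℤ d → Set} {c} → Enumeration P c → HasExactly P c
  hasExactly {P = P} E =
    tabulate (element E) , tabulate⁺ (injective E) ,
    (λ x → mk⇔ (λ x∈ → let i , eq = ∈-tabulate⁻ x∈ in subst P (sym eq) (sound E i))
               (λ Px → let i , eq = complete E Px in subst (_∈ tabulate (element E)) eq (∈-tabulate⁺ i))) ,
    length-tabulate (element E)

  module _ {A : Set} where

    resp-enumeration : ∀ {P Q : A → Set} {c} → (∀ {x} → P x → Q x) → (∀ {x} → Q x → P x) →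
                       Enumeration P c → Enumeration Q c
    resp-enumeration P⇒Q Q⇒P E = record
      { element = element E ; injective = injective E
      ; sound = λ i → P⇒Q (sound E i) ; complete = λ Qx → complete E (Q⇒P Qx) }

    singleton-enumeration : (a : A) → Enumeration (a ≡_) 1
    singleton-enumeration a = record
      { element = λ _ → a ; injective = λ { {Fin.zero} {Fin.zero} _ → refl }
      ; sound = λ _ → refl ; complete = λ a≡x → Fin.zero , a≡x }

    ⊎-enumeration : ∀ {P Q : A → Set} {a b} → Enumeration P a → Enumeration Q b →
                    (∀ {x} → P x → Q x → ⊥) → Enumeration (λ x → P x ⊎ Q x) (a + b)
    ⊎-enumeration {P} {Q} {a} {b} E F disjoint = record
      { element = element′ ; injective = injective′ ; sound = sound′ ; complete = complete′ }
      where
      from⊎ : Fin a ⊎ Fin b → A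
      from⊎ = [ element E , element F ]
      from⊎-injective : Injective _≡_ _≡_ from⊎
      from⊎-injective {inj₁ i} {inj₁ j} eq = cong inj₁ (injective E eq)
      from⊎-injective {inj₂ i} {inj₂ j} eq = cong inj₂ (injective F eq)
      from⊎-injective {inj₁ i} {inj₂ j} eq = ⊥-elim (disjoint (sound E i) (subst Q (sym eq) (sound F j)))
      from⊎-injective {inj₂ i} {inj₁ j} eq = ⊥-elim (disjoint (sound E j) (subst Q eq (sound F i)))
      element′ : Fin (a + b) → A
      element′ k = from⊎ (splitAt a k)
      injective′ : Injective _≡_ _≡_ element′
      injective′ {i} {j} eq = begin
        i                      ≡⟨ join-splitAt a b i ⟨
        join a b (splitAt a i) ≡⟨ cong (join a b) (from⊎-injective {splitAt a i} {splitAt a j} eq) ⟩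
        join a b (splitAt a j) ≡⟨ join-splitAt a b j ⟩
        j                      ∎
        where open ≡-Reasoning
      sound′ : ∀ k → P (element′ k) ⊎ Q (element′ k)
      sound′ k with splitAt a k
      ... | inj₁ i = inj₁ (sound E i)
      ... | inj₂ j = inj₂ (sound F j)
      complete′ : ∀ {x} → P x ⊎ Q x → ∃[ k ] element′ k ≡ x
      complete′ (inj₁ Px) = let i , eq = complete E Px in i ↑ˡ b , trans (cong from⊎ (splitAt-↑ˡ a i b)) eq
      complete′ (inj₂ Qx) = let j , eq = complete F Qx in a ↑ʳ j , trans (cong from⊎ (splitAt-↑ʳ a b j)) eq

    image-enumeration : ∀ {B : Set} {P : B → Set} {c} {f : B → A} → Injective _≡_ _≡_ f →
                        Enumeration P c → Enumeration (Image f P) c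
    image-enumeration {f = f} f-injective E = record
      { element = λ i → f (element E i)
      ; injective = λ eq → injective E (f-injective eq)
      ; sound = λ i → element E i , sound E i , refl
      ; complete = λ { (x , Px , refl) → let i , eq = complete E Px in i , cong f eq } }

    ⋃-enumeration : ∀ (Q : ℕ → A → Set) {c : ℕ → ℕ} K → (∀ i → i < K → Enumeration (Q i) (c i)) →
                    (∀ {i j x} → i < K → j < K → Q i x → Q j x → i ≡ j) → Enumeration (⋃< K Q) (Σ< K c)
    ⋃-enumeration Q zero    E disjoint = record
      { element = λ () ; injective = λ { {()} } ; sound = λ () ; complete = λ { (_ , () , _) } }
    ⋃-enumeration Q (suc K) E disjoint =
      resp-enumeration to from
        (⊎-enumeration (⋃-enumeration Q K (λ i i<K → E i (m<n⇒m<1+n i<K))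
                                          (λ i<K j<K → disjoint (m<n⇒m<1+n i<K) (m<n⇒m<1+n j<K)))
                       (E K ≤-refl)
                       (λ { (i , i<K , Qix) QKx → <-irrefl (disjoint (m<n⇒m<1+n i<K) ≤-refl Qix QKx) i<K }))
      where
      to : ∀ {x} → ⋃< K Q x ⊎ Q K x → ⋃< (suc K) Q x
      to (inj₁ (i , i<K , Qix)) = i , m<n⇒m<1+n i<K , Qix
      to (inj₂ QKx)             = K , ≤-refl , QKx
      from : ∀ {x} → ⋃< (suc K) Q x → ⋃< K Q x ⊎ Q K x
      from (i , s≤s i≤K , Qix) with m≤n⇒m<n∨m≡n i≤K
      ... | inj₁ i<K  = inj₁ (i , i<K , Qix)
      ... | inj₂ refl = inj₂ Qix

module Arithmetic where

  open import Data.Nat using (ℕ; zero; suc; _+_; _*_; _^_; _∸_; _≤_; _<_; z≤n; s≤s)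
  open import Data.Nat.Properties
  open import Data.Nat.Combinatorics using (_C_; nCn≡1)
  open import Data.Nat.Tactic.RingSolver using (solve-∀)
  open import Data.Fin using (Fin; toℕ)
  open import Data.Sum using (inj₁; inj₂)
  open import Function.Base using (_∘_)
  open import Relation.Binary.PropositionalEquality
  open import Algebra.Properties.CommutativeSemigroup +-commutativeSemigroup using (interchange)
  open import Algebra.Properties.Monoid.Sum +-0-monoid using (sum; sum-cong-≗)
  open import Algebra.Properties.Monoid.Mult +-0-monoid using () renaming (_×_ to _×′_)
  open import Algebra.Properties.Semiring.Exp +-*-semiring using () renaming (_^_ to _^′_)
  open import Algebra.Properties.CommutativeSemiring.Binomial +-*-commutativeSemiring using (theorem)
  open import Defs using (Σ<)

  open ≡-Reasoning

  𝟙[_<_] : ℕ → ℕ → ℕ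
  𝟙[ _     < zero  ] = 0
  𝟙[ zero  < suc _ ] = 1
  𝟙[ suc a < suc b ] = 𝟙[ a < b ]

  𝟙[<]≡1 : ∀ {a b} → a < b → 𝟙[ a < b ] ≡ 1
  𝟙[<]≡1 {zero}  {suc b} _         = refl
  𝟙[<]≡1 {suc a} {suc b} (s≤s a<b) = 𝟙[<]≡1 a<b

  𝟙[≮]≡0 : ∀ {a b} → b ≤ a → 𝟙[ a < b ] ≡ 0
  𝟙[≮]≡0 {a}     {zero}  _         = refl
  𝟙[≮]≡0 {suc a} {suc b} (s≤s b≤a) = 𝟙[≮]≡0 b≤a

  𝟙[<]≤1 : ∀ a b → 𝟙[ a < b ] ≤ 1
  𝟙[<]≤1 _       zero    = z≤n
  𝟙[<]≤1 zero    (suc _) = ≤-refl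
  𝟙[<]≤1 (suc a) (suc b) = 𝟙[<]≤1 a b

  Σ<-cong : ∀ K {f g : ℕ → ℕ} → (∀ {i} → i < K → f i ≡ g i) → Σ< K f ≡ Σ< K g
  Σ<-cong zero    f≗g = refl
  Σ<-cong (suc K) f≗g = cong₂ _+_ (Σ<-cong K (λ i<K → f≗g (m<n⇒m<1+n i<K))) (f≗g ≤-refl)

  Σ<-+ : ∀ K (f g : ℕ → ℕ) → Σ< K (λ i → f i + g i) ≡ Σ< K f + Σ< K g
  Σ<-+ zero    f g = refl
  Σ<-+ (suc K) f g = begin
    Σ< K (λ i → f i + g i) + (f K + g K) ≡⟨ cong (_+ (f K + g K)) (Σ<-+ K f g) ⟩
    Σ< K f + Σ< K g + (f K + g K)         ≡⟨ interchange (Σ< K f) (Σ< K g) (f K) (g K) ⟩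
    Σ< K f + f K + (Σ< K g + g K)         ∎

  Σ<-const : ∀ K c → Σ< K (λ _ → c) ≡ K * c
  Σ<-const zero    c = refl
  Σ<-const (suc K) c = trans (cong (_+ c) (Σ<-const K c)) (+-comm (K * c) c)

  Σ<-suc : ∀ K (f : ℕ → ℕ) → Σ< (suc K) f ≡ f 0 + Σ< K (λ i → f (suc i))
  Σ<-suc zero    f = +-comm 0 (f 0)
  Σ<-suc (suc K) f = trans (cong (_+ f (suc K)) (Σ<-suc K f)) (+-assoc (f 0) _ _)

  Σ<-reverse : ∀ s (f : ℕ → ℕ) → Σ< (suc s) (λ i → f (s ∸ i)) ≡ Σ< (suc s) f
  Σ<-reverse zero    f = refl
  Σ<-reverse (suc s) f = begin
    Σ< (suc (suc s)) (λ i → f (suc s ∸ i)) ≡⟨ Σ<-suc (suc s) _ ⟩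
    f (suc s) + Σ< (suc s) (λ i → f (s ∸ i)) ≡⟨ cong (f (suc s) +_) (Σ<-reverse s f) ⟩
    f (suc s) + Σ< (suc s) f                 ≡⟨ +-comm (f (suc s)) _ ⟩
    Σ< (suc (suc s)) f                       ∎

  Σ<-𝟙[<] : ∀ {a′ K} → a′ ≤ K → (f : ℕ → ℕ) → Σ< K (λ a → 𝟙[ a < a′ ] * f a) ≡ Σ< a′ f
  Σ<-𝟙[<] {a′} {zero}  z≤n f = refl
  Σ<-𝟙[<] {a′} {suc K} a′≤1+K f with m≤n⇒m<n∨m≡n a′≤1+K
  ... | inj₁ (s≤s a′≤K) = begin
    Σ< K (λ a → 𝟙[ a < a′ ] * f a) + 𝟙[ K < a′ ] * f K
      ≡⟨ cong₂ _+_ (Σ<-𝟙[<] a′≤K f) (cong (_* f K) (𝟙[≮]≡0 a′≤K)) ⟩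
    Σ< a′ f + 0                                       ≡⟨ +-identityʳ _ ⟩
    Σ< a′ f                                           ∎
  ... | inj₂ refl = cong₂ _+_ (Σ<-cong K (λ a<K → trans (cong (_* f _) (𝟙[<]≡1 (m<n⇒m<1+n a<K))) (*-identityˡ _)))
                              (trans (cong (_* f K) (𝟙[<]≡1 {K} ≤-refl)) (*-identityˡ (f K)))

  -- box n v a counts the lattice points of [1, v]^a × [0, v]^(n - a).
  box : ℕ → ℕ → ℕ → ℕ
  box n v a = v ^ a * suc v ^ (n ∸ a)

  box-partial-geometric : ∀ {n a′} v → a′ ≤ suc n → Σ< a′ (box n v) + box (suc n) v a′ ≡ suc v ^ suc n
  box-partial-geometric {n} {zero}   v _ = *-identityˡ (suc v ^ suc n)
  box-partial-geometric {n} {suc a′} v (s≤s a′≤n) = begin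
    Σ< a′ (box n v) + box n v a′ + box (suc n) v (suc a′)   ≡⟨ +-assoc (Σ< a′ (box n v)) _ _ ⟩
    Σ< a′ (box n v) + (box n v a′ + box (suc n) v (suc a′)) ≡⟨ cong (Σ< a′ (box n v) +_) merge ⟩
    Σ< a′ (box n v) + box (suc n) v a′                      ≡⟨ box-partial-geometric v (m≤n⇒m≤1+n a′≤n) ⟩
    suc v ^ suc n                                           ∎
    where
    factor : ∀ v p q → p * q + v * p * q ≡ p * (suc v * q)
    factor = solve-∀
    merge : box n v a′ + box (suc n) v (suc a′) ≡ box (suc n) v a′
    merge = begin
      v ^ a′ * suc v ^ (n ∸ a′) + v * v ^ a′ * suc v ^ (n ∸ a′) ≡⟨ factor v (v ^ a′) (suc v ^ (n ∸ a′)) ⟩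
      v ^ a′ * suc v ^ suc (n ∸ a′)                             ≡⟨ cong ((v ^ a′ *_) ∘ (suc v ^_)) (+-∸-assoc 1 a′≤n) ⟨
      v ^ a′ * suc v ^ (suc n ∸ a′)                             ∎

  box-cumulative : ∀ n V → Σ< (suc n) (λ a → Σ< V (λ w → box n w a)) ≡ V ^ suc n
  box-cumulative n zero    = trans (Σ<-const (suc n) 0) (*-zeroʳ n)
  box-cumulative n (suc V) = begin
    Σ< (suc n) (λ a → Σ< V (λ w → box n w a) + box n V a)            ≡⟨ Σ<-+ (suc n) _ (box n V) ⟩
    Σ< (suc n) (λ a → Σ< V (λ w → box n w a)) + Σ< (suc n) (box n V) ≡⟨ cong (_+ Σ< (suc n) (box n V)) (box-cumulative n V) ⟩
    V ^ suc n + Σ< (suc n) (box n V)                                  ≡⟨ +-comm (V ^ suc n) _ ⟩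
    Σ< (suc n) (box n V) + V ^ suc n                                  ≡⟨ cong (Σ< (suc n) (box n V) +_) top-box ⟨
    Σ< (suc n) (box n V) + box (suc n) V (suc n)                      ≡⟨ box-partial-geometric {n} V ≤-refl ⟩
    suc V ^ suc n                                                     ∎
    where
    top-box : box (suc n) V (suc n) ≡ V ^ suc n
    top-box = trans (cong (λ e → V ^ suc n * suc V ^ e) (n∸n≡0 n)) (*-identityʳ (V ^ suc n))

  Σ<-∸𝟙 : ∀ {ℓ} v (g : ℕ → ℕ) → ℓ ≤ 1 → Σ< (suc v ∸ ℓ) g + ℓ * g v ≡ Σ< (suc v) g
  Σ<-∸𝟙 v g z≤n       = +-identityʳ _
  Σ<-∸𝟙 v g (s≤s z≤n) = cong (Σ< v g +_) (+-identityʳ (g v))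

  box-recursion : ∀ {n a′} v → a′ ≤ suc n →
                  Σ< (suc n) (λ a → Σ< (suc v ∸ 𝟙[ a < a′ ]) (λ w → box n w a)) ≡ box (suc n) v a′
  box-recursion {n} {a′} v a′≤1+n = +-cancelʳ-≡ (Σ< a′ (box n v)) _ _ (begin
    S + Σ< a′ (box n v)                                             ≡⟨ cong (S +_) (Σ<-𝟙[<] a′≤1+n (box n v)) ⟨
    S + Σ< (suc n) (λ a → 𝟙[ a < a′ ] * box n v a)                  ≡⟨ Σ<-+ (suc n) _ _ ⟨
    Σ< (suc n) (λ a → Σ< (suc v ∸ 𝟙[ a < a′ ]) (λ w → box n w a) + 𝟙[ a < a′ ] * box n v a)
      ≡⟨ Σ<-cong (suc n) (λ {a} _ → Σ<-∸𝟙 v (λ w → box n w a) (𝟙[<]≤1 a a′)) ⟩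
    Σ< (suc n) (λ a → Σ< (suc v) (λ w → box n w a))                 ≡⟨ box-cumulative n (suc v) ⟩
    suc v ^ suc n                                                   ≡⟨ box-partial-geometric v a′≤1+n ⟨
    Σ< a′ (box n v) + box (suc n) v a′                              ≡⟨ +-comm (Σ< a′ (box n v)) _ ⟩
    box (suc n) v a′ + Σ< a′ (box n v)                              ∎)
    where
    S = Σ< (suc n) (λ a → Σ< (suc v ∸ 𝟙[ a < a′ ]) (λ w → box n w a))

  box-total : ∀ n s → Σ< (suc n) (λ a → Σ< (suc s) (λ A → box n (s ∸ A) a)) ≡ suc s ^ suc n
  box-total n s = trans (Σ<-cong (suc n) (λ {a} _ → Σ<-reverse s (λ w → box n w a))) (box-cumulative n (suc s))

  Σ<≡sum : ∀ K f → Σ< K f ≡ sum (λ (i : Fin K) → f (toℕ i))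
  Σ<≡sum zero    f = refl
  Σ<≡sum (suc K) f = trans (Σ<-suc K f) (cong (f 0 +_) (Σ<≡sum K (λ i → f (suc i))))

  ×′≡* : ∀ k x → k ×′ x ≡ k * x
  ×′≡* zero    x = refl
  ×′≡* (suc k) x = cong (x +_) (×′≡* k x)

  ^′≡^ : ∀ x k → x ^′ k ≡ x ^ k
  ^′≡^ x zero    = refl
  ^′≡^ x (suc k) = cong (x *_) (^′≡^ x k)

  binomial : ∀ d t → Σ< (suc d) (λ i → (d C i) * t ^ i) ≡ suc t ^ d
  binomial d t = begin
    Σ< (suc d) (λ i → (d C i) * t ^ i)                                 ≡⟨ Σ<≡sum (suc d) (λ i → (d C i) * t ^ i) ⟩
    sum {suc d} (λ k → (d C toℕ k) * t ^ toℕ k)                        ≡⟨ sum-cong-≗ {suc d} (λ k → term (toℕ k)) ⟩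
    sum {suc d} (λ k → (d C toℕ k) ×′ (t ^′ toℕ k * 1 ^′ (d ∸ toℕ k))) ≡⟨ theorem d t 1 ⟨
    (t + 1) ^′ d                                                       ≡⟨ ^′≡^ (t + 1) d ⟩
    (t + 1) ^ d                                                        ≡⟨ cong (_^ d) (+-comm t 1) ⟩
    suc t ^ d                                                          ∎
    where
    term : ∀ k → (d C k) * t ^ k ≡ (d C k) ×′ (t ^′ k * 1 ^′ (d ∸ k))
    term k = sym (begin
      (d C k) ×′ (t ^′ k * 1 ^′ (d ∸ k)) ≡⟨ ×′≡* (d C k) _ ⟩
      (d C k) * (t ^′ k * 1 ^′ (d ∸ k))  ≡⟨ cong₂ (λ a b → (d C k) * (a * b)) (^′≡^ t k) (^′≡^ 1 (d ∸ k)) ⟩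
      (d C k) * (t ^ k * 1 ^ (d ∸ k))    ≡⟨ cong (λ b → (d C k) * (t ^ k * b)) (^-zeroˡ (d ∸ k)) ⟩
      (d C k) * (t ^ k * 1)              ≡⟨ cong ((d C k) *_) (*-identityʳ (t ^ k)) ⟩
      (d C k) * t ^ k                    ∎)

  ehrhart-arithmetic : ∀ n {m t} → 1 ≤ m → 1 ≤ t →
    Σ< m (λ r → suc (t ∸ 𝟙[ 0 < r ]) ^ suc n) ≡ m * t ^ suc n + Σ< (suc n) (λ i → (suc n C i) * t ^ i)
  ehrhart-arithmetic n {suc m} {t@(suc _)} _ _ = begin
    Σ< (suc m) (λ r → suc (t ∸ 𝟙[ 0 < r ]) ^ suc n)       ≡⟨ Σ<-suc m _ ⟩
    suc t ^ suc n + Σ< m (λ _ → t ^ suc n)                ≡⟨ cong₂ _+_ (sym (binomial (suc n) t)) (Σ<-const m _) ⟩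
    S + (suc n C suc n) * t ^ suc n + m * t ^ suc n       ≡⟨ cong (λ c → S + c * t ^ suc n + m * t ^ suc n) (nCn≡1 (suc n)) ⟩
    S + 1 * t ^ suc n + m * t ^ suc n                     ≡⟨ rearrange S (t ^ suc n) m ⟩
    suc m * t ^ suc n + S                                 ∎
    where
    S = Σ< (suc n) (λ i → (suc n C i) * t ^ i)
    rearrange : ∀ S T m → S + 1 * T + m * T ≡ (1 + m) * T + S
    rearrange = solve-∀

module Vectors where

  open import Data.Fin using (Fin; inject₁; fromℕ)
  open import Data.Vec using (Vec; []; _∷_; _∷ʳ_; lookup; foldr)
  open import Algebra.Bundles using (Monoid)
  open import Relation.Binary.PropositionalEquality using (_≡_; refl)

  lookup-∷ʳ-inject₁ : ∀ {A : Set} {n} (xs : Vec A n) x i → lookup (xs ∷ʳ x) (inject₁ i) ≡ lookup xs i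
  lookup-∷ʳ-inject₁ (_ ∷ _)  x Fin.zero    = refl
  lookup-∷ʳ-inject₁ (_ ∷ xs) x (Fin.suc i) = lookup-∷ʳ-inject₁ xs x i

  lookup-∷ʳ-fromℕ : ∀ {A : Set} {n} (xs : Vec A n) x → lookup (xs ∷ʳ x) (fromℕ n) ≡ x
  lookup-∷ʳ-fromℕ []       x = refl
  lookup-∷ʳ-fromℕ (_ ∷ xs) x = lookup-∷ʳ-fromℕ xs x

  module _ {c ℓ} (M : Monoid c ℓ) where
    open Monoid M using (Carrier; _∙_; ε; _≈_; identityˡ; identityʳ; assoc; ∙-congˡ) renaming (setoid to carrier-setoid)
    open import Relation.Binary.Reasoning.Setoid carrier-setoid

    foldr-∷ʳ : ∀ {n} (xs : Vec Carrier n) x → foldr _ _∙_ ε (xs ∷ʳ x) ≈ foldr _ _∙_ ε xs ∙ x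
    foldr-∷ʳ []       x = begin
      x ∙ ε ≈⟨ identityʳ x ⟩
      x     ≈⟨ identityˡ x ⟨
      ε ∙ x ∎
    foldr-∷ʳ (y ∷ xs) x = begin
      y ∙ foldr _ _∙_ ε (xs ∷ʳ x)   ≈⟨ ∙-congˡ (foldr-∷ʳ xs x) ⟩
      y ∙ (foldr _ _∙_ ε xs ∙ x)    ≈⟨ assoc y _ x ⟨
      y ∙ foldr _ _∙_ ε xs ∙ x      ∎

module LatticePoints where

  open import Data.Nat as ℕ using (ℕ; zero; suc; _!; _^_; z≤n; s≤s; NonZero; _/_; _%_)
  import Data.Nat.Properties as ℕ
  import Data.Nat.Tactic.RingSolver as ℕ-Solver
  open import Data.Nat.DivMod using (m/n*n≤m; n/1≡n; m/n/o≡m/[n*o]; /-congʳ; m≡m%n+[m/n]*n; [m+kn]%n≡m%n;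
                                     m<n⇒m%n≡m; +-distrib-/; m*n/n≡m; m<n⇒m/n≡0; m*n%n≡0; m%n<n)
  open import Data.Integer as ℤ using (ℤ; +_; -[1+_]; 0ℤ; 1ℤ; -1ℤ; _+_; _-_; _*_; -_; _≤_; +≤+; -≤-; +<+; ∣_∣; positive)
  open import Data.Integer.Properties
  open import Data.Integer.Tactic.RingSolver using (solve-∀)
  open import Data.Fin using (Fin; toℕ; inject₁; fromℕ)
  open import Data.Fin.Properties using (toℕ-inject₁; toℕ-fromℕ)
  open import Data.Fin.Relation.Unary.Top using (view; ‵fromℕ; ‵inject₁)
  open import Data.Vec as Vec using (Vec; []; _∷_; _∷ʳ_; lookup; map; foldr; tabulate; initLast)
  open import Data.Vec.Properties using (lookup-map; ∷ʳ-injective)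
  open import Data.Product using (_×_; _,_; proj₁; proj₂; ∃-syntax)
  open import Data.Sum using (inj₁; inj₂)
  open import Function.Base using (id)
  open import Function.Bundles using (_⇔_; mk⇔; Equivalence)
  open import Function.Definitions using (Injective)
  open import Function.Properties.Equivalence using (⇔-setoid)
  open import Level using (0ℓ)
  import Relation.Binary.Reasoning.Setoid
  open import Relation.Binary.PropositionalEquality
  open import Relation.Nullary using (contradiction)
  open import Defs using (Σ<)
  open Vectors
  open Enumerations
  open Arithmetic using (𝟙[_<_]; 𝟙[<]≡1; 𝟙[≮]≡0; 𝟙[<]≤1; box; box-recursion; box-total)

  sumℤ : ∀ {n} → Vec ℤ n → ℤ
  sumℤ = foldr _ _+_ 0ℤ

  -- κ j is the paper's i! + (i-1)! for i = j + 1, and lookup (ρ n) j = (n+1)!/κ j = -q_{j+1}(n+1).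
  κ : ℕ → ℕ
  κ j = suc j ! ℕ.+ j !

  ρ : (n : ℕ) → Vec ℕ n
  ρ zero    = []
  ρ (suc n) = map (suc (suc n) ℕ.*_) (ρ n) ∷ʳ suc n

  κ*ρ≡! : ∀ n (j : Fin n) → κ (toℕ j) ℕ.* lookup (ρ n) j ≡ suc n !
  κ*ρ≡! (suc n) j with view j
  ... | ‵fromℕ = begin
    κ (toℕ (fromℕ n)) ℕ.* lookup (map (suc (suc n) ℕ.*_) (ρ n) ∷ʳ suc n) (fromℕ n)
      ≡⟨ cong₂ (λ a b → κ a ℕ.* b) (toℕ-fromℕ n) (lookup-∷ʳ-fromℕ (map (suc (suc n) ℕ.*_) (ρ n)) (suc n)) ⟩
    κ n ℕ.* suc n
      ≡⟨ last-factor n (n !) ⟩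
    suc (suc n) !  ∎
    where
    open ≡-Reasoning
    last-factor : ∀ n f → ((1 ℕ.+ n) ℕ.* f ℕ.+ f) ℕ.* (1 ℕ.+ n) ≡ (2 ℕ.+ n) ℕ.* ((1 ℕ.+ n) ℕ.* f)
    last-factor = ℕ-Solver.solve-∀
  ... | ‵inject₁ i = begin
    κ (toℕ (inject₁ i)) ℕ.* lookup (map (suc (suc n) ℕ.*_) (ρ n) ∷ʳ suc n) (inject₁ i)
      ≡⟨ cong₂ (λ a b → κ a ℕ.* b) (toℕ-inject₁ i)
               (trans (lookup-∷ʳ-inject₁ (map (suc (suc n) ℕ.*_) (ρ n)) (suc n) i) (lookup-map i (suc (suc n) ℕ.*_) (ρ n))) ⟩
    κ (toℕ i) ℕ.* (suc (suc n) ℕ.* lookup (ρ n) i)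
      ≡⟨ ℕ.*-comm (κ (toℕ i)) (suc (suc n) ℕ.* lookup (ρ n) i) ⟩
    suc (suc n) ℕ.* lookup (ρ n) i ℕ.* κ (toℕ i)
      ≡⟨ ℕ.*-assoc (suc (suc n)) (lookup (ρ n) i) (κ (toℕ i)) ⟩
    suc (suc n) ℕ.* (lookup (ρ n) i ℕ.* κ (toℕ i))
      ≡⟨ cong (suc (suc n) ℕ.*_) (trans (ℕ.*-comm (lookup (ρ n) i) (κ (toℕ i))) (κ*ρ≡! n i)) ⟩
    suc (suc n) !  ∎
    where open ≡-Reasoning

  sum-ρ : ∀ n → Vec.sum (ρ n) ℕ.+ 1 ≡ suc n !
  sum-ρ zero    = refl
  sum-ρ (suc n) = begin
    Vec.sum (map (suc (suc n) ℕ.*_) (ρ n) ∷ʳ suc n) ℕ.+ 1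
      ≡⟨ cong (ℕ._+ 1) (foldr-∷ʳ ℕ.+-0-monoid (map (suc (suc n) ℕ.*_) (ρ n)) (suc n)) ⟩
    Vec.sum (map (suc (suc n) ℕ.*_) (ρ n)) ℕ.+ suc n ℕ.+ 1
      ≡⟨ cong (λ s → s ℕ.+ suc n ℕ.+ 1) (sum-map-* {suc (suc n)} (ρ n)) ⟩
    suc (suc n) ℕ.* Vec.sum (ρ n) ℕ.+ suc n ℕ.+ 1
      ≡⟨ factor n (Vec.sum (ρ n)) ⟩
    suc (suc n) ℕ.* (Vec.sum (ρ n) ℕ.+ 1)
      ≡⟨ cong (suc (suc n) ℕ.*_) (sum-ρ n) ⟩
    suc (suc n) !  ∎
    where
    open ≡-Reasoning
    factor : ∀ n s → (2 ℕ.+ n) ℕ.* s ℕ.+ (1 ℕ.+ n) ℕ.+ 1 ≡ (2 ℕ.+ n) ℕ.* (s ℕ.+ 1)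
    factor = ℕ-Solver.solve-∀
    sum-map-* : ∀ {c k} (xs : Vec ℕ k) → Vec.sum (map (c ℕ.*_) xs) ≡ c ℕ.* Vec.sum xs
    sum-map-* {c} []       = sym (ℕ.*-zeroʳ c)
    sum-map-* {c} (x ∷ xs) = trans (cong (c ℕ.* x ℕ.+_) (sum-map-* {c} xs)) (sym (ℕ.*-distribˡ-+ c x (Vec.sum xs)))

  weighted-sum : ∀ {n} (ys : Vec ℤ n) (es : Vec ℕ n) (c : Fin n → ℕ) {M} (b : ℤ) →
                 (∀ j → c j ℕ.* lookup es j ≡ M) →
                 sumℤ (tabulate (λ j → + lookup es j * (+ c j * lookup ys j + b))) ≡ + M * sumℤ ys + b * + Vec.sum es
  weighted-sum []       []       c {M} b _   = sym (trans (cong₂ _+_ (*-zeroʳ (+ M)) (*-zeroʳ b)) (+-identityʳ 0ℤ))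
  weighted-sum (y ∷ ys) (e ∷ es) c {M} b c*e≡M = begin
    + e * (+ c₀ * y + b) + sumℤ (tabulate (λ j → + lookup es j * (+ c (Fin.suc j) * lookup ys j + b)))
      ≡⟨ cong (_+_ (+ e * (+ c₀ * y + b))) (weighted-sum ys es (λ j → c (Fin.suc j)) b (λ j → c*e≡M (Fin.suc j))) ⟩
    + e * (+ c₀ * y + b) + (+ M * sumℤ ys + b * + Vec.sum es)
      ≡⟨ cong (λ m → + e * (+ c₀ * y + b) + (m * sumℤ ys + b * + Vec.sum es)) M≡c₀e ⟩
    + e * (+ c₀ * y + b) + (+ c₀ * + e * sumℤ ys + b * + Vec.sum es)
      ≡⟨ collect (+ e) (+ c₀) y b (sumℤ ys) (+ Vec.sum es) ⟩
    + c₀ * + e * (y + sumℤ ys) + b * (+ e + + Vec.sum es)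
      ≡⟨ cong₂ (λ m s → m * (y + sumℤ ys) + b * s) (sym M≡c₀e) (sym (pos-+ e (Vec.sum es))) ⟩
    + M * (y + sumℤ ys) + b * + (e ℕ.+ Vec.sum es) ∎
    where
    open ≡-Reasoning
    c₀ = c Fin.zero
    M≡c₀e : + M ≡ + c₀ * + e
    M≡c₀e = trans (cong +_ (sym (c*e≡M Fin.zero))) (pos-* c₀ e)
    collect : ∀ e c y b s σ → e * (c * y + b) + (c * e * s + b * σ) ≡ c * e * (y + s) + b * (e + σ)
    collect = solve-∀

  sumℤ-nonneg : ∀ {n} (f : Fin n → ℤ) → (∀ j → 0ℤ ≤ f j) → 0ℤ ≤ sumℤ (tabulate f)
  sumℤ-nonneg {zero}  f _   = +≤+ z≤n
  sumℤ-nonneg {suc n} f 0≤f = +-mono-≤ (0≤f Fin.zero) (sumℤ-nonneg (λ j → f (Fin.suc j)) (λ j → 0≤f (Fin.suc j)))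

  0≤+* : ∀ e {z} → 0ℤ ≤ z → 0ℤ ≤ + e * z
  0≤+* e {z} 0≤z = subst (_≤ + e * z) (*-zeroʳ (+ e)) (*-monoˡ-≤-nonNeg (+ e) 0≤z)

  pos-∸ : ∀ {m n} → n ℕ.≤ m → + (m ℕ.∸ n) ≡ + m - + n
  pos-∸ {m} {n} n≤m = sym (trans (m-n≡m⊖n m n) (⊖-≥ n≤m))

  0≤f*X+w⇔0≤X : ∀ {f w} (X : ℤ) → w ℕ.< f → 0ℤ ≤ + f * X + + w ⇔ 0ℤ ≤ X
  0≤f*X+w⇔0≤X {f} {w} X w<f = mk⇔ (to X) (from X)
    where
    to : ∀ X → 0ℤ ≤ + f * X + + w → 0ℤ ≤ X
    to (+ _)    _  = +≤+ z≤n
    to -[1+ p ] 0≤ = contradiction (drop‿+≤+ f≤w) (ℕ.<⇒≱ w<f)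
      where
      open ≤-Reasoning
      minus-f : ∀ f w → f * -1ℤ + w ≡ w - f
      minus-f = solve-∀
      f≤w : + f ≤ + w
      f≤w = 0≤i-j⇒j≤i (begin
        0ℤ                   ≤⟨ 0≤ ⟩
        + f * -[1+ p ] + + w ≤⟨ +-monoˡ-≤ (+ w) (*-monoˡ-≤-nonNeg (+ f) (-≤- z≤n)) ⟩
        + f * -1ℤ + + w      ≡⟨ minus-f (+ f) (+ w) ⟩
        + w - + f            ∎)
    from : ∀ X → 0ℤ ≤ X → 0ℤ ≤ + f * X + + w
    from (+ x) _ = subst (0ℤ ≤_) (trans (pos-+ (f ℕ.* x) w) (cong (_+ + w) (pos-* f x))) (+≤+ z≤n)

  module ⇔-Reasoning = Relation.Binary.Reasoning.Setoid (⇔-setoid 0ℓ)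

  0≤[2+n]D+a-a′⇔𝟙≤D : ∀ {n a a′} (D : ℤ) → a ℕ.≤ n → a′ ℕ.≤ suc n →
                       0ℤ ≤ + (2 ℕ.+ n) * D + (+ a - + a′) ⇔ + 𝟙[ a < a′ ] ≤ D
  0≤[2+n]D+a-a′⇔𝟙≤D {n} {a} {a′} D a≤n a′≤1+n with ℕ.≤-<-connex a′ a
  ... | inj₁ a′≤a = begin
    0ℤ ≤ + K * D + (+ a - + a′)  ≡⟨ cong (λ x → 0ℤ ≤ + K * D + x) (pos-∸ a′≤a) ⟨
    0ℤ ≤ + K * D + + (a ℕ.∸ a′)  ≈⟨ 0≤f*X+w⇔0≤X D (ℕ.s≤s (ℕ.≤-trans (ℕ.m∸n≤m a a′) (ℕ.m≤n⇒m≤1+n a≤n))) ⟩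
    0ℤ ≤ D                       ≡⟨ cong (λ c → + c ≤ D) (𝟙[≮]≡0 a′≤a) ⟨
    + 𝟙[ a < a′ ] ≤ D            ∎
    where
    open ⇔-Reasoning
    K = 2 ℕ.+ n
  ... | inj₂ a<a′ = begin
    0ℤ ≤ + K * D + (+ a - + a′)              ≡⟨ cong (0ℤ ≤_) carry ⟩
    0ℤ ≤ + K * (D - 1ℤ) + + (a ℕ.+ K ℕ.∸ a′)
      ≈⟨ 0≤f*X+w⇔0≤X (D - 1ℤ) (ℕ.m<n+o⇒m∸n<o (a ℕ.+ K) a′ (ℕ.+-monoˡ-< K a<a′)) ⟩
    0ℤ ≤ D - 1ℤ                              ≈⟨ mk⇔ 0≤i-j⇒j≤i i≤j⇒0≤j-i ⟩
    1ℤ ≤ D                                   ≡⟨ cong (λ c → + c ≤ D) (𝟙[<]≡1 a<a′) ⟨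
    + 𝟙[ a < a′ ] ≤ D                        ∎
    where
    open ⇔-Reasoning
    K = 2 ℕ.+ n
    borrow : ∀ K D a a′ → K * D + (a - a′) ≡ K * (D - 1ℤ) + (a + K - a′)
    borrow = solve-∀
    carry : + K * D + (+ a - + a′) ≡ + K * (D - 1ℤ) + + (a ℕ.+ K ℕ.∸ a′)
    carry = trans (borrow (+ K) D (+ a) (+ a′)) (trans
              (cong (λ x → + K * (D - 1ℤ) + (x - + a′)) (sym (pos-+ a K)))
              (cong (_+_ (+ K * (D - 1ℤ))) (sym (pos-∸ a′≤a+K))))
      where
      a′≤a+K : a′ ℕ.≤ a ℕ.+ K
      a′≤a+K = ℕ.≤-trans (ℕ.m≤n⇒m≤1+n a′≤1+n) (ℕ.m≤n+m K a)

  <1+v∸ℓ⇔ℓ+w≤v : ∀ {ℓ v w} → ℓ ℕ.≤ 1 → w ℕ.< suc v ℕ.∸ ℓ ⇔ ℓ ℕ.+ w ℕ.≤ v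
  <1+v∸ℓ⇔ℓ+w≤v z≤n       = mk⇔ ℕ.s≤s⁻¹ s≤s
  <1+v∸ℓ⇔ℓ+w≤v (s≤s z≤n) = mk⇔ id id

  +ℓ≤+v-+w⇔ℓ+w≤v : ∀ {ℓ v w} → + ℓ ≤ + v - + w ⇔ ℓ ℕ.+ w ℕ.≤ v
  +ℓ≤+v-+w⇔ℓ+w≤v {ℓ} {v} {w} = mk⇔
    (λ ℓ≤v-w → drop‿+≤+ (subst₂ _≤_ (sym (pos-+ ℓ w)) (cancel (+ v) (+ w)) (+-monoˡ-≤ (+ w) ℓ≤v-w)))
    (λ ℓ+w≤v → subst (_≤ + v - + w) (trans (cong (_- + w) (pos-+ ℓ w)) (cancel′ (+ ℓ) (+ w)))
                                        (+-monoˡ-≤ (- + w) (+≤+ ℓ+w≤v)))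
    where
    cancel : ∀ v w → v - w + w ≡ v
    cancel = solve-∀
    cancel′ : ∀ ℓ w → ℓ + w - w ≡ ℓ
    cancel′ = solve-∀

  x+[V-W]≤V⇔x≤W : ∀ x V W → x + (V - W) ≤ V ⇔ x ≤ W
  x+[V-W]≤V⇔x≤W x V W = mk⇔
    (λ le → subst₂ _≤_ (shift x V W) (cancel V W) (+-monoˡ-≤ (W - V) le))
    (λ le → subst (x + (V - W) ≤_) (cancel′ V W) (+-monoˡ-≤ (V - W) le))
    where
    shift : ∀ x V W → x + (V - W) + (W - V) ≡ x
    shift = solve-∀
    cancel : ∀ V W → V + (W - V) ≡ W
    cancel = solve-∀
    cancel′ : ∀ V W → W + (V - W) ≡ V
    cancel′ = solve-∀

  +m*Z+[K*m+r]≡+m*[Z+K]+r : ∀ m (Z : ℤ) K r → + m * Z + + (K ℕ.* m ℕ.+ r) ≡ + m * (Z + + K) + + r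
  +m*Z+[K*m+r]≡+m*[Z+K]+r m Z K r = begin
    + m * Z + + (K ℕ.* m ℕ.+ r)      ≡⟨ cong (_+_ (+ m * Z)) (trans (pos-+ (K ℕ.* m) r) (cong (_+ + r) (pos-* K m))) ⟩
    + m * Z + (+ K * + m + + r)      ≡⟨ distribute (+ m) Z (+ K) (+ r) ⟩
    + m * (Z + + K) + + r            ∎
    where
    open ≡-Reasoning
    distribute : ∀ m Z K r → m * Z + (K * m + r) ≡ m * (Z + K) + r
    distribute = solve-∀

  m*X+r≤m*t⇔X≤t∸𝟙 : ∀ {m r t} (X : ℤ) → r ℕ.< m → 1 ℕ.≤ t →
                     + m * X + + r ≤ + (m ℕ.* t) ⇔ X ≤ + (t ℕ.∸ 𝟙[ 0 < r ])
  m*X+r≤m*t⇔X≤t∸𝟙 {m} {zero} {t} X 0<m _ = begin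
    + m * X + 0ℤ ≤ + (m ℕ.* t)   ≡⟨ cong₂ _≤_ (+-identityʳ (+ m * X)) (pos-* m t) ⟩
    + m * X ≤ + m * + t          ≈⟨ mk⇔ (*-cancelˡ-≤-pos X (+ t) (+ m) {{positive (+<+ 0<m)}}) (*-monoˡ-≤-nonNeg (+ m)) ⟩
    X ≤ + t                      ∎
    where open ⇔-Reasoning
  m*X+r≤m*t⇔X≤t∸𝟙 {m} {suc r} {t} X r<m 1≤t = begin
    + m * X + + suc r ≤ + (m ℕ.* t)                      ≈⟨ mk⇔ i≤j⇒0≤j-i 0≤i-j⇒j≤i ⟩
    0ℤ ≤ + (m ℕ.* t) - (+ m * X + + suc r)               ≡⟨ cong (0ℤ ≤_) regroup ⟩
    0ℤ ≤ + m * (+ t - 1ℤ - X) + + (m ℕ.∸ suc r)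
      ≈⟨ 0≤f*X+w⇔0≤X (+ t - 1ℤ - X) (ℕ.∸-monoʳ-< (s≤s z≤n) (ℕ.<⇒≤ r<m)) ⟩
    0ℤ ≤ + t - 1ℤ - X                                    ≈⟨ mk⇔ 0≤i-j⇒j≤i i≤j⇒0≤j-i ⟩
    X ≤ + t - 1ℤ                                         ≡⟨ cong (X ≤_) (pos-∸ 1≤t) ⟨
    X ≤ + (t ℕ.∸ 1)                                      ∎
    where
    open ⇔-Reasoning
    split : ∀ m t X r → m * t - (m * X + r) ≡ m * (t - 1ℤ - X) + (m - r)
    split = solve-∀
    regroup : + (m ℕ.* t) - (+ m * X + + suc r) ≡ + m * (+ t - 1ℤ - X) + + (m ℕ.∸ suc r)
    regroup = trans (cong (λ x → x - (+ m * X + + suc r)) (pos-* m t))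
                    (trans (split (+ m) (+ t) X (+ suc r)) (cong (_+_ (+ m * (+ t - 1ℤ - X))) (sym (pos-∸ (ℕ.<⇒≤ r<m)))))

  infixl 7 _/!_
  _/!_ : ℕ → ℕ → ℕ
  k /! n = (k / n !) {{n ℕ.!≢0}}

  _%!_ : ℕ → ℕ → ℕ
  k %! n = (k % n !) {{n ℕ.!≢0}}

  %!<! : ∀ k n → k %! n ℕ.< n !
  %!<! k n = m%n<n k (n !) {{n ℕ.!≢0}}

  %!+/!*! : ∀ k n → k ≡ k %! n ℕ.+ k /! n ℕ.* n !
  %!+/!*! k n = m≡m%n+[m/n]*n k (n !) {{n ℕ.!≢0}}

  /!-zero : ∀ k → k /! 0 ≡ k
  /!-zero = n/1≡n

  /!-suc : ∀ k n → k /! suc n ≡ k /! n / suc n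
  /!-suc k n = sym (trans (m/n/o≡m/[n*o] k (n !) (suc n)) (/-congʳ (ℕ.*-comm (n !) (suc n))))
    where
    instance
      _ = n ℕ.!≢0
      _ = ℕ.m*n≢0 (n !) (suc n)
      _ = suc n ℕ.!≢0

  /!-digits : ∀ k n → k /! n ≡ k /! suc n ℕ.* suc n ℕ.+ k /! n % suc n
  /!-digits k n = begin
    k /! n                                          ≡⟨ m≡m%n+[m/n]*n (k /! n) (suc n) ⟩
    k /! n % suc n ℕ.+ k /! n / suc n ℕ.* suc n     ≡⟨ ℕ.+-comm (k /! n % suc n) _ ⟩
    k /! n / suc n ℕ.* suc n ℕ.+ k /! n % suc n     ≡⟨ cong (λ q → q ℕ.* suc n ℕ.+ k /! n % suc n) (/!-suc k n) ⟨
    k /! suc n ℕ.* suc n ℕ.+ k /! n % suc n         ∎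
    where open ≡-Reasoning

  module _ {d} .{{_ : NonZero d}} where

    [q*d+r]%d≡r : ∀ q {r} → r ℕ.< d → (q ℕ.* d ℕ.+ r) % d ≡ r
    [q*d+r]%d≡r q {r} r<d = trans (cong (_% d) (ℕ.+-comm (q ℕ.* d) r)) (trans ([m+kn]%n≡m%n r q d) (m<n⇒m%n≡m r<d))

    [q*d+r]/d≡q : ∀ q {r} → r ℕ.< d → (q ℕ.* d ℕ.+ r) / d ≡ q
    [q*d+r]/d≡q q {r} r<d = begin
      (q ℕ.* d ℕ.+ r) / d    ≡⟨ +-distrib-/ (q ℕ.* d) r (subst (ℕ._< d) (sym remainders) r<d) ⟩
      q ℕ.* d / d ℕ.+ r / d  ≡⟨ cong₂ ℕ._+_ (m*n/n≡m q d) (m<n⇒m/n≡0 r<d) ⟩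
      q ℕ.+ 0                ≡⟨ ℕ.+-identityʳ q ⟩
      q                      ∎
      where
      open ≡-Reasoning
      remainders : (q ℕ.* d) % d ℕ.+ r % d ≡ r
      remainders = cong₂ ℕ._+_ (m*n%n≡0 q d) (m<n⇒m%n≡m r<d)

    quotRem-injective : ∀ {q₁ q₂ r₁ r₂} → r₁ ℕ.< d → r₂ ℕ.< d →
                        q₁ ℕ.* d ℕ.+ r₁ ≡ q₂ ℕ.* d ℕ.+ r₂ → q₁ ≡ q₂ × r₁ ≡ r₂
    quotRem-injective {q₁} {q₂} r₁<d r₂<d eq =
      trans (sym ([q*d+r]/d≡q q₁ r₁<d)) (trans (cong (_/ d) eq) ([q*d+r]/d≡q q₂ r₂<d)) ,
      trans (sym ([q*d+r]%d≡r q₁ r₁<d)) (trans (cong (_% d) eq) ([q*d+r]%d≡r q₂ r₂<d))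

  Point : ℕ → Set
  Point n = Vec ℤ n × ℕ

  Cone : ∀ {n} → Point n → Set
  Cone {n} (ys , k) = ∀ (j : Fin n) → 0ℤ ≤ + κ (toℕ j) * lookup ys j + + k

  level : ∀ {n} → Point n → ℤ
  level (ys , k) = sumℤ ys + + k

  cone-∷ʳ⇔ : ∀ {n} (ys : Vec ℤ n) y k → Cone (ys ∷ʳ y , k) ⇔ (Cone (ys , k) × 0ℤ ≤ + κ n * y + + k)
  cone-∷ʳ⇔ {n} ys y k = mk⇔ to from
    where
    facet : ℕ → ℤ → Set
    facet i z = 0ℤ ≤ + κ i * z + + k
    to : Cone (ys ∷ʳ y , k) → Cone (ys , k) × facet n y
    to cone = (λ j → subst₂ facet (toℕ-inject₁ j) (lookup-∷ʳ-inject₁ ys y j) (cone (inject₁ j)))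
            , subst₂ facet (toℕ-fromℕ n) (lookup-∷ʳ-fromℕ ys y) (cone (fromℕ n))
    from : Cone (ys , k) × facet n y → Cone (ys ∷ʳ y , k)
    from (cone , last) j with view j
    ... | ‵fromℕ     = subst₂ facet (sym (toℕ-fromℕ n)) (sym (lookup-∷ʳ-fromℕ ys y)) last
    ... | ‵inject₁ i = subst₂ facet (sym (toℕ-inject₁ i)) (sym (lookup-∷ʳ-inject₁ ys y i)) (cone i)

  level-∷ʳ : ∀ {n} (ys : Vec ℤ n) y k → level (ys ∷ʳ y , k) ≡ level (ys , k) + y
  level-∷ʳ ys y k = trans (cong (_+ + k) (foldr-∷ʳ +-0-monoid ys y)) (swap (sumℤ ys) y (+ k))
    where
    swap : ∀ s y k → s + y + k ≡ s + k + y
    swap = solve-∀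

  -- Weighting the facet inequalities by ρ shows (n+1)! · level ≥ k.
  period≤level : ∀ {n} (p : Point n) → Cone p → + (proj₂ p /! suc n) ≤ level p
  period≤level {n} (ys , k) cone =
    *-cancelˡ-≤-pos (+ (k /! suc n)) (level (ys , k)) (+ F) {{positive (+<+ (ℕ.1≤n! (suc n)))}} (begin
      + F * + (k /! suc n) ≡⟨ pos-* F (k /! suc n) ⟨
      + (F ℕ.* (k /! suc n)) ≤⟨ +≤+ (subst (ℕ._≤ k) (ℕ.*-comm (k /! suc n) F) (m/n*n≤m k F)) ⟩
      + k ≤⟨ +-monoˡ-≤ (+ k) (sumℤ-nonneg _ (λ j → 0≤+* (lookup (ρ n) j) (cone j))) ⟩
      W + + k ≡⟨ cong (_+ + k) (weighted-sum ys (ρ n) (λ j → κ (toℕ j)) (+ k) (κ*ρ≡! n)) ⟩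
      + F * sumℤ ys + + k * + Vec.sum (ρ n) + + k
        ≡⟨ distribute (+ F) (sumℤ ys) (+ k) _ (trans (cong +_ (sym (sum-ρ n))) (pos-+ (Vec.sum (ρ n)) 1)) ⟩
      + F * (sumℤ ys + + k) ∎)
    where
    open ≤-Reasoning
    F = suc n !
    instance _ = suc n ℕ.!≢0
    W = sumℤ (tabulate (λ j → + lookup (ρ n) j * (+ κ (toℕ j) * lookup ys j + + k)))
    distribute : ∀ F s k σ → F ≡ σ + 1ℤ → F * s + k * σ + k ≡ F * (s + k)
    distribute _ s k σ refl = factor s k σ
      where
      factor : ∀ s k σ → (σ + 1ℤ) * s + k * σ + k ≡ (σ + 1ℤ) * (s + k)
      factor = solve-∀

  facet-decomposition : ∀ {n A a a′ k} (y : ℤ) → k /! n ≡ (A ℕ.* (2 ℕ.+ n) ℕ.+ a′) ℕ.* suc n ℕ.+ a →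
                        + κ n * y + + k ≡ + (n !) * (+ (2 ℕ.+ n) * (y + + (A ℕ.* suc n ℕ.+ a′)) + (+ a - + a′)) + + (k %! n)
  facet-decomposition {n} {A} {a} {a′} {k} y k-block = begin
    + κ n * y + + k
      ≡⟨ cong₂ (λ c k′ → c * y + k′) κ≡ k≡ ⟩
    (N * F + F) * y + (+ (k %! n) + ((+ A * (1ℤ + N) + + a′) * N + + a) * F)
      ≡⟨ regroup y F N (+ (k %! n)) (+ A) (+ a) (+ a′) ⟩
    F * ((1ℤ + N) * (y + (+ A * N + + a′)) + (+ a - + a′)) + + (k %! n)
      ≡⟨ cong₂ (λ c o → F * (c * (y + o) + (+ a - + a′)) + + (k %! n)) (sym [2+n]≡1+N) (sym offset≡) ⟩
    F * (+ (2 ℕ.+ n) * (y + + (A ℕ.* suc n ℕ.+ a′)) + (+ a - + a′)) + + (k %! n) ∎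
    where
    open ≡-Reasoning
    F = + (n !)
    N = + suc n
    [2+n]≡1+N : + (2 ℕ.+ n) ≡ 1ℤ + N
    [2+n]≡1+N = pos-+ 1 (suc n)
    κ≡ : + κ n ≡ N * F + F
    κ≡ = trans (pos-+ (suc n ℕ.* n !) (n !)) (cong (_+ F) (pos-* (suc n) (n !)))
    offset≡ : + (A ℕ.* suc n ℕ.+ a′) ≡ + A * N + + a′
    offset≡ = trans (pos-+ (A ℕ.* suc n) a′) (cong (_+ + a′) (pos-* A (suc n)))
    block≡ : + (k /! n) ≡ (+ A * (1ℤ + N) + + a′) * N + + a
    block≡ = begin
      + (k /! n)                                          ≡⟨ cong +_ k-block ⟩
      + ((A ℕ.* (2 ℕ.+ n) ℕ.+ a′) ℕ.* suc n ℕ.+ a)        ≡⟨ pos-+ _ a ⟩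
      + ((A ℕ.* (2 ℕ.+ n) ℕ.+ a′) ℕ.* suc n) + + a        ≡⟨ cong (_+ + a) (pos-* (A ℕ.* (2 ℕ.+ n) ℕ.+ a′) (suc n)) ⟩
      + (A ℕ.* (2 ℕ.+ n) ℕ.+ a′) * N + + a                ≡⟨ cong (λ x → x * N + + a) (pos-+ (A ℕ.* (2 ℕ.+ n)) a′) ⟩
      (+ (A ℕ.* (2 ℕ.+ n)) + + a′) * N + + a              ≡⟨ cong (λ x → (x + + a′) * N + + a) (pos-* A (2 ℕ.+ n)) ⟩
      (+ A * + (2 ℕ.+ n) + + a′) * N + + a                ≡⟨ cong (λ x → (+ A * x + + a′) * N + + a) [2+n]≡1+N ⟩
      (+ A * (1ℤ + N) + + a′) * N + + a                   ∎
    k≡ : + k ≡ + (k %! n) + ((+ A * (1ℤ + N) + + a′) * N + + a) * F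
    k≡ = begin
      + k                                    ≡⟨ cong +_ (%!+/!*! k n) ⟩
      + (k %! n ℕ.+ k /! n ℕ.* n !)          ≡⟨ pos-+ (k %! n) _ ⟩
      + (k %! n) + + (k /! n ℕ.* n !)        ≡⟨ cong (_+_ (+ (k %! n))) (pos-* (k /! n) (n !)) ⟩
      + (k %! n) + + (k /! n) * F            ≡⟨ cong (λ q → + (k %! n) + q * F) block≡ ⟩
      + (k %! n) + ((+ A * (1ℤ + N) + + a′) * N + + a) * F ∎
    regroup : ∀ y F N r A a a′ → (N * F + F) * y + (r + ((A * (1ℤ + N) + a′) * N + a) * F) ≡
                                  F * ((1ℤ + N) * (y + (A * N + a′)) + (a - a′)) + r
    regroup = solve-∀

  cone-last⇔ : ∀ {n A a a′ k} (y : ℤ) → a ℕ.≤ n → a′ ℕ.≤ suc n →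
               k /! n ≡ (A ℕ.* (2 ℕ.+ n) ℕ.+ a′) ℕ.* suc n ℕ.+ a →
               0ℤ ≤ + κ n * y + + k ⇔ + 𝟙[ a < a′ ] ≤ y + + (A ℕ.* suc n ℕ.+ a′)
  cone-last⇔ {n} {A} {a} {a′} {k} y a≤n a′≤1+n k-block = begin
    0ℤ ≤ + κ n * y + + k                  ≡⟨ cong (0ℤ ≤_) (facet-decomposition {n} {A} {a} {a′} {k} y k-block) ⟩
    0ℤ ≤ + (n !) * X + + (k %! n)         ≈⟨ 0≤f*X+w⇔0≤X X (%!<! k n) ⟩
    0ℤ ≤ X                                ≈⟨ 0≤[2+n]D+a-a′⇔𝟙≤D D a≤n a′≤1+n ⟩
    + 𝟙[ a < a′ ] ≤ D                     ∎
    where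
    open ⇔-Reasoning
    D = y + + (A ℕ.* suc n ℕ.+ a′)
    X = + (2 ℕ.+ n) * D + (+ a - + a′)

  Block : (n A a v : ℕ) → Point n → Set
  Block n A a v (ys , k) = Cone (ys , k) × k /! n ≡ A ℕ.* suc n ℕ.+ a × level (ys , k) ≤ + (v ℕ.+ A)

  -- A point of Block (n+1) A a′ v is a point of Block n A′ a w extended by the coordinate lastCoord w, where a is
  -- the next digit of k and w the slack left by the level bound; the last facet restricts w to w ≤ v - 𝟙[ a < a′ ].
  module BlockRecursion (n A a′ v : ℕ) (a′≤1+n : a′ ℕ.≤ suc n) where

    A′ : ℕ
    A′ = A ℕ.* (2 ℕ.+ n) ℕ.+ a′

    offset : ℕ
    offset = A ℕ.* suc n ℕ.+ a′

    lastCoord : ℕ → ℤ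
    lastCoord w = + (v ℕ.+ A) - + (w ℕ.+ A′)

    extend : ℕ → Point n → Point (suc n)
    extend w (ys , k) = ys ∷ʳ lastCoord w , k

    lastCoord+offset : ∀ w → lastCoord w + + offset ≡ + v - + w
    lastCoord+offset w = begin
      + (v ℕ.+ A) - + (w ℕ.+ A′) + + offset
        ≡⟨ cong₂ (λ x y → x - y + + offset) (pos-+ v A) (pos-+ w A′) ⟩
      + v + + A - (+ w + + A′) + + offset
        ≡⟨ cong₂ (λ x y → + v + + A - (+ w + x) + y) A′≡ offset≡ ⟩
      + v + + A - (+ w + (+ A * (1ℤ + + suc n) + + a′)) + (+ A * + suc n + + a′)
        ≡⟨ telescope (+ v) (+ A) (+ w) (+ suc n) (+ a′) ⟩
      + v - + w ∎
      where
      open ≡-Reasoning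
      telescope : ∀ v A w N a′ → v + A - (w + (A * (1ℤ + N) + a′)) + (A * N + a′) ≡ v - w
      telescope = solve-∀
      A′≡ : + A′ ≡ + A * (1ℤ + + suc n) + + a′
      A′≡ = trans (pos-+ (A ℕ.* (2 ℕ.+ n)) a′) (cong (_+ + a′) (trans (pos-* A (2 ℕ.+ n)) (cong (+ A *_) (pos-+ 1 (suc n)))))
      offset≡ : + offset ≡ + A * + suc n + + a′
      offset≡ = trans (pos-+ (A ℕ.* suc n) a′) (cong (_+ + a′) (pos-* A (suc n)))

    extend-injective : ∀ w → Injective _≡_ _≡_ (extend w)
    extend-injective w {ys₁ , k₁} {ys₂ , k₂} eq =
      cong₂ _,_ (proj₁ (∷ʳ-injective ys₁ ys₂ (cong proj₁ eq))) (cong proj₂ eq)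

    lastCoord-injective : ∀ {w₁ w₂} → lastCoord w₁ ≡ lastCoord w₂ → w₁ ≡ w₂
    lastCoord-injective {w₁} {w₂} eq = +-injective (begin
      + w₁                      ≡⟨ solve (+ v) (+ w₁) ⟩
      + v - (+ v - + w₁)        ≡⟨ cong (λ x → + v - x) (trans (sym (lastCoord+offset w₁))
                                                             (trans (cong (_+ + offset) eq) (lastCoord+offset w₂))) ⟩
      + v - (+ v - + w₂)        ≡⟨ solve (+ v) (+ w₂) ⟨
      + w₂                      ∎)
      where
      open ≡-Reasoning
      solve : ∀ v w → w ≡ v - (v - w)
      solve = solve-∀

    lastCoord-onto : ∀ y → + A′ + y ≤ + (v ℕ.+ A) → ∃[ w ] y ≡ lastCoord w
    lastCoord-onto y A′+y≤v+A = ∣ slack ∣ , (begin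
      y                                ≡⟨ cancel (+ (v ℕ.+ A)) (+ A′) y ⟩
      + (v ℕ.+ A) - (slack + + A′)     ≡⟨ cong (λ x → + (v ℕ.+ A) - (x + + A′)) (0≤i⇒+∣i∣≡i 0≤slack) ⟨
      + (v ℕ.+ A) - (+ ∣ slack ∣ + + A′) ≡⟨ cong (λ x → + (v ℕ.+ A) - x) (pos-+ ∣ slack ∣ A′) ⟨
      lastCoord ∣ slack ∣              ∎)
      where
      open ≡-Reasoning
      slack = + (v ℕ.+ A) - y - + A′
      rearrange : ∀ V A′ y → V - (A′ + y) ≡ V - y - A′
      rearrange = solve-∀
      0≤slack : 0ℤ ≤ slack
      0≤slack = subst (0ℤ ≤_) (rearrange (+ (v ℕ.+ A)) (+ A′) y) (i≤j⇒0≤j-i A′+y≤v+A)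
      cancel : ∀ V A′ y → y ≡ V - ((V - y - A′) + A′)
      cancel = solve-∀

    Piece : ℕ → ℕ → Point (suc n) → Set
    Piece a w = Image (extend w) (Block n A′ a w)

    Layer : ℕ → Point (suc n) → Set
    Layer a = ⋃< (suc v ℕ.∸ 𝟙[ a < a′ ]) (Piece a)

    piece-disjoint : ∀ {a w₁ w₂ p} → Piece a w₁ p → Piece a w₂ p → w₁ ≡ w₂
    piece-disjoint ((ys₁ , k₁) , _ , refl) ((ys₂ , k₂) , _ , eq) =
      sym (lastCoord-injective (proj₂ (∷ʳ-injective ys₂ ys₁ (cong proj₁ eq))))

    layer-disjoint : ∀ {a₁ a₂ p} → Layer a₁ p → Layer a₂ p → a₁ ≡ a₂
    layer-disjoint (_ , _ , (_ , k₁) , (_ , k₁-block , _) , refl) (_ , _ , (_ , k₂) , (_ , k₂-block , _) , eq) =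
      ℕ.+-cancelˡ-≡ (A′ ℕ.* suc n) _ _ (trans (sym k₁-block) (trans (cong (_/! n) (sym (cong proj₂ eq))) k₂-block))

    piece⊆block : ∀ {a w p} → a ℕ.< suc n → w ℕ.< suc v ℕ.∸ 𝟙[ a < a′ ] →
                  Block n A′ a w p → Block (suc n) A a′ v (extend w p)
    piece⊆block {a} {w} {ys , k} a<1+n w<1+v∸𝟙 (cone , k-block , level≤) =
      Equivalence.from (cone-∷ʳ⇔ ys (lastCoord w) k)
        (cone , Equivalence.from (cone-last⇔ {n} {A} {a} {a′} {k} (lastCoord w) (ℕ.s≤s⁻¹ a<1+n) a′≤1+n k-block)
                                 𝟙≤lastCoord+offset) ,
      trans (/!-suc k n) (trans (cong (_/ suc n) k-block) ([q*d+r]/d≡q A′ a<1+n)) ,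
      subst (_≤ + (v ℕ.+ A)) (sym (level-∷ʳ ys (lastCoord w) k))
        (Equivalence.from (x+[V-W]≤V⇔x≤W (level (ys , k)) (+ (v ℕ.+ A)) (+ (w ℕ.+ A′))) level≤)
      where
      𝟙≤lastCoord+offset : + 𝟙[ a < a′ ] ≤ lastCoord w + + offset
      𝟙≤lastCoord+offset = subst (+ 𝟙[ a < a′ ] ≤_) (sym (lastCoord+offset w))
        (Equivalence.from +ℓ≤+v-+w⇔ℓ+w≤v (Equivalence.to (<1+v∸ℓ⇔ℓ+w≤v (𝟙[<]≤1 a a′)) w<1+v∸𝟙))

    layers⊆block : ∀ {p} → ⋃< (suc n) Layer p → Block (suc n) A a′ v p
    layers⊆block (a , a<1+n , w , w< , q , q∈block , refl) = piece⊆block {p = q} a<1+n w< q∈block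

    block⊆layers : ∀ {p} → Block (suc n) A a′ v p → ⋃< (suc n) Layer p
    block⊆layers {zs , k} (cone , k-block , level≤) with initLast zs
    ... | ys , y , refl =
      a , a<1+n , w , w<1+v∸𝟙 , (ys , k) , (cone-ys , digits , level-ys) , cong (λ y′ → ys ∷ʳ y′ , k) (sym y≡lastCoord)
      where
      a = k /! n % suc n
      a<1+n = m%n<n (k /! n) (suc n)
      digits : k /! n ≡ A′ ℕ.* suc n ℕ.+ a
      digits = trans (/!-digits k n) (cong (λ q → q ℕ.* suc n ℕ.+ a) k-block)
      cone-ys : Cone (ys , k)
      cone-ys = proj₁ (Equivalence.to (cone-∷ʳ⇔ ys y k) cone)
      𝟙≤y+offset : + 𝟙[ a < a′ ] ≤ y + + offset
      𝟙≤y+offset = Equivalence.to (cone-last⇔ {n} {A} {a} {a′} {k} y (ℕ.s≤s⁻¹ a<1+n) a′≤1+n digits)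
                     (proj₂ (Equivalence.to (cone-∷ʳ⇔ ys y k) cone))
      A′≤level : + A′ ≤ level (ys , k)
      A′≤level = subst (λ q → + q ≤ level (ys , k)) k-block (period≤level (ys , k) cone-ys)
      y-as-lastCoord = lastCoord-onto y (≤-trans (+-monoˡ-≤ y A′≤level) (subst (_≤ + (v ℕ.+ A)) (level-∷ʳ ys y k) level≤))
      w = proj₁ y-as-lastCoord
      y≡lastCoord : y ≡ lastCoord w
      y≡lastCoord = proj₂ y-as-lastCoord
      w<1+v∸𝟙 : w ℕ.< suc v ℕ.∸ 𝟙[ a < a′ ]
      w<1+v∸𝟙 = Equivalence.from (<1+v∸ℓ⇔ℓ+w≤v (𝟙[<]≤1 a a′)) (Equivalence.to +ℓ≤+v-+w⇔ℓ+w≤v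
                  (subst (+ 𝟙[ a < a′ ] ≤_) (trans (cong (_+ + offset) y≡lastCoord) (lastCoord+offset w)) 𝟙≤y+offset))
      level-ys : level (ys , k) ≤ + (w ℕ.+ A′)
      level-ys = Equivalence.to (x+[V-W]≤V⇔x≤W (level (ys , k)) (+ (v ℕ.+ A)) (+ (w ℕ.+ A′)))
                   (subst (_≤ + (v ℕ.+ A)) (trans (level-∷ʳ ys y k) (cong (_+_ (level (ys , k))) y≡lastCoord)) level≤)

  block-enumeration : ∀ n A {a} v → a ℕ.≤ n → Enumeration (Block n A a v) (box n v a)
  block-enumeration zero    A {zero} v z≤n = resp-enumeration A∈block block∋A (singleton-enumeration ([] , A))
    where
    A*1+0≡A : A ℕ.* 1 ℕ.+ 0 ≡ A
    A*1+0≡A = trans (ℕ.+-identityʳ _) (ℕ.*-identityʳ A)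
    A∈block : ∀ {p} → ([] , A) ≡ p → Block 0 A 0 v p
    A∈block refl = (λ ()) , trans (/!-zero A) (sym A*1+0≡A) , +≤+ (ℕ.m≤n+m A v)
    block∋A : ∀ {p} → Block 0 A 0 v p → ([] , A) ≡ p
    block∋A {[] , k} (_ , k-block , _) = cong ([] ,_) (sym (trans (sym (/!-zero k)) (trans k-block A*1+0≡A)))
  block-enumeration (suc n) A {a′} v a′≤1+n =
    subst (Enumeration (Block (suc n) A a′ v)) (box-recursion v a′≤1+n)
      (resp-enumeration layers⊆block block⊆layers
        (⋃-enumeration Layer (suc n)
          (λ a a<1+n → ⋃-enumeration (Piece a) (suc v ℕ.∸ 𝟙[ a < a′ ])
            (λ w _ → image-enumeration (extend-injective w) (block-enumeration n A′ w (ℕ.s≤s⁻¹ a<1+n)))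
            (λ _ _ → piece-disjoint))
          (λ _ _ → layer-disjoint)))
    where open BlockRecursion n A a′ v a′≤1+n

  UnitPoints : (n s : ℕ) → Point n → Set
  UnitPoints n s p = Cone p × level p ≤ + s

  unit-points-enumeration : ∀ n s → Enumeration (UnitPoints n s) (suc s ^ suc n)
  unit-points-enumeration n s =
    subst (Enumeration (UnitPoints n s)) (box-total n s)
      (resp-enumeration (λ {p} → blocks⊆points {p}) (λ {p} → points⊆blocks {p})
        (⋃-enumeration Blocks (suc n)
          (λ a a<1+n → ⋃-enumeration (λ A → Block n A a (s ℕ.∸ A)) (suc s)
            (λ A _ → block-enumeration n A (s ℕ.∸ A) (ℕ.s≤s⁻¹ a<1+n))
            (λ {A₁} {A₂} {p} _ _ → period-disjoint {A₁ = A₁} {A₂} {p} a<1+n))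
          (λ {a₁} {a₂} {p} → digit-disjoint {a₁} {a₂} {p})))
    where
    Blocks : ℕ → Point n → Set
    Blocks a = ⋃< (suc s) (λ A → Block n A a (s ℕ.∸ A))
    period-disjoint : ∀ {a A₁ A₂ p} → a ℕ.< suc n →
                      Block n A₁ a (s ℕ.∸ A₁) p → Block n A₂ a (s ℕ.∸ A₂) p → A₁ ≡ A₂
    period-disjoint a<1+n (_ , A₁-block , _) (_ , A₂-block , _) =
      proj₁ (quotRem-injective a<1+n a<1+n (trans (sym A₁-block) A₂-block))
    digit-disjoint : ∀ {a₁ a₂ p} → a₁ ℕ.< suc n → a₂ ℕ.< suc n → Blocks a₁ p → Blocks a₂ p → a₁ ≡ a₂
    digit-disjoint a₁<1+n a₂<1+n (A₁ , _ , _ , a₁-block , _) (A₂ , _ , _ , a₂-block , _) =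
      proj₂ (quotRem-injective {q₁ = A₁} {A₂} a₁<1+n a₂<1+n (trans (sym a₁-block) a₂-block))
    blocks⊆points : ∀ {p} → ⋃< (suc n) Blocks p → UnitPoints n s p
    blocks⊆points {ys , k} (_ , _ , A , A<1+s , cone , _ , level≤) =
      cone , subst (λ x → _ ≤ + x) (ℕ.m∸n+n≡m (ℕ.s≤s⁻¹ A<1+s)) level≤
    points⊆blocks : ∀ {p} → UnitPoints n s p → ⋃< (suc n) Blocks p
    points⊆blocks {ys , k} (cone , level≤s) =
      k /! n % suc n , m%n<n (k /! n) (suc n) , k /! suc n , s≤s A≤s ,
      cone , /!-digits k n , subst (λ x → level (ys , k) ≤ + x) (sym (ℕ.m∸n+n≡m A≤s)) level≤s
      where
      A≤s : k /! suc n ℕ.≤ s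
      A≤s = drop‿+≤+ (≤-trans (period≤level (ys , k) cone) level≤s)

  FacetInequalities : (m t : ℕ) → ∀ {n} → Vec ℤ n → ℤ → Set
  FacetInequalities m t {n} ys kz =
    (∀ (j : Fin n) → 0ℤ ≤ + (m ℕ.* κ (toℕ j)) * lookup ys j + kz) × + m * sumℤ ys + kz ≤ + (m ℕ.* t)

  Points : (m t : ℕ) → ∀ {n} → Point n → Set
  Points m t (ys , k) = FacetInequalities m t ys (+ k)

  scale-facet⇔ : ∀ {m r} c (y : ℤ) K → r ℕ.< m → 0ℤ ≤ + (m ℕ.* c) * y + + (K ℕ.* m ℕ.+ r) ⇔ 0ℤ ≤ + c * y + + K
  scale-facet⇔ {m} {r} c y K r<m = begin
    0ℤ ≤ + (m ℕ.* c) * y + + (K ℕ.* m ℕ.+ r)  ≡⟨ cong (λ x → 0ℤ ≤ x * y + + (K ℕ.* m ℕ.+ r)) (pos-* m c) ⟩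
    0ℤ ≤ + m * + c * y + + (K ℕ.* m ℕ.+ r)    ≡⟨ cong (λ x → 0ℤ ≤ x + + (K ℕ.* m ℕ.+ r)) (*-assoc (+ m) (+ c) y) ⟩
    0ℤ ≤ + m * (+ c * y) + + (K ℕ.* m ℕ.+ r)  ≡⟨ cong (0ℤ ≤_) (+m*Z+[K*m+r]≡+m*[Z+K]+r m (+ c * y) K r) ⟩
    0ℤ ≤ + m * (+ c * y + + K) + + r          ≈⟨ 0≤f*X+w⇔0≤X (+ c * y + + K) r<m ⟩
    0ℤ ≤ + c * y + + K                        ∎
    where open ⇔-Reasoning

  scale-bound⇔ : ∀ {m r n} t (ys : Vec ℤ n) K → r ℕ.< m → 1 ℕ.≤ t →
                 + m * sumℤ ys + + (K ℕ.* m ℕ.+ r) ≤ + (m ℕ.* t) ⇔ level (ys , K) ≤ + (t ℕ.∸ 𝟙[ 0 < r ])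
  scale-bound⇔ {m} {r} t ys K r<m 1≤t = begin
    + m * sumℤ ys + + (K ℕ.* m ℕ.+ r) ≤ + (m ℕ.* t)  ≡⟨ cong (_≤ + (m ℕ.* t)) (+m*Z+[K*m+r]≡+m*[Z+K]+r m (sumℤ ys) K r) ⟩
    + m * level (ys , K) + + r ≤ + (m ℕ.* t)         ≈⟨ m*X+r≤m*t⇔X≤t∸𝟙 (level (ys , K)) r<m 1≤t ⟩
    level (ys , K) ≤ + (t ℕ.∸ 𝟙[ 0 < r ])           ∎
    where open ⇔-Reasoning

  points-enumeration : ∀ n {m t} → 1 ℕ.≤ m → 1 ℕ.≤ t →
                       Enumeration (Points m t {n}) (Σ< m (λ r → suc (t ℕ.∸ 𝟙[ 0 < r ]) ^ suc n))
  points-enumeration n {m} {t} 1≤m 1≤t =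
    resp-enumeration (λ {p} → residues⊆points {p}) (λ {p} → points⊆residues {p})
      (⋃-enumeration Residue m
        (λ r _ → image-enumeration (scale-injective r) (unit-points-enumeration n (t ℕ.∸ 𝟙[ 0 < r ])))
        (λ {r₁} {r₂} {p} → residue-disjoint {r₁} {r₂} {p}))
    where
    instance _ = ℕ.>-nonZero 1≤m
    scale : ℕ → Point n → Point n
    scale r (ys , K) = ys , K ℕ.* m ℕ.+ r
    Residue : ℕ → Point n → Set
    Residue r = Image (scale r) (UnitPoints n (t ℕ.∸ 𝟙[ 0 < r ]))
    scale-injective : ∀ r → Injective _≡_ _≡_ (scale r)
    scale-injective r {_ , K₁} {_ , K₂} eq =
      cong₂ _,_ (cong proj₁ eq) (ℕ.*-cancelʳ-≡ K₁ K₂ m (ℕ.+-cancelʳ-≡ r _ _ (cong proj₂ eq)))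
    residue-disjoint : ∀ {r₁ r₂ p} → r₁ ℕ.< m → r₂ ℕ.< m → Residue r₁ p → Residue r₂ p → r₁ ≡ r₂
    residue-disjoint r₁<m r₂<m ((_ , K₁) , _ , refl) ((_ , K₂) , _ , eq) =
      sym (proj₂ (quotRem-injective {q₁ = K₂} {K₁} r₂<m r₁<m (cong proj₂ eq)))
    residues⊆points : ∀ {p} → ⋃< m Residue p → Points m t p
    residues⊆points (r , r<m , (ys , K) , (cone , level≤) , refl) =
      (λ j → Equivalence.from (scale-facet⇔ (κ (toℕ j)) (lookup ys j) K r<m) (cone j)) ,
      Equivalence.from (scale-bound⇔ t ys K r<m 1≤t) level≤
    points⊆residues : ∀ {p} → Points m t p → ⋃< m Residue p
    points⊆residues {ys , k} (facets , bound) =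
      k % m , m%n<n k m , (ys , k / m) ,
      ((λ j → Equivalence.to (scale-facet⇔ (κ (toℕ j)) (lookup ys j) (k / m) (m%n<n k m))
                (subst (λ x → 0ℤ ≤ + (m ℕ.* κ (toℕ j)) * lookup ys j + + x) k≡ (facets j))) ,
       Equivalence.to (scale-bound⇔ t ys (k / m) (m%n<n k m) 1≤t) (subst (λ x → + m * sumℤ ys + + x ≤ _) k≡ bound)) ,
      cong (ys ,_) (sym k≡)
      where
      k≡ : k ≡ k / m ℕ.* m ℕ.+ k % m
      k≡ = trans (m≡m%n+[m/n]*n k m) (ℕ.+-comm (k % m) _)

module ConvexHull where

  open import Data.Nat as ℕ using (ℕ; zero; suc; _!; z≤n)
  import Data.Nat.Properties as ℕ
  open import Data.Nat.DivMod using (_/_; m*n/n≡m)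
  open import Data.Nat.Coprimality using (1-coprimeTo) renaming (sym to coprime-sym)
  open import Data.Integer as ℤ using (ℤ; +_; -[1+_]; +≤+)
  import Data.Integer.Properties as ℤ
  import Data.Integer.Tactic.RingSolver as ℤ-Solver
  open import Data.Rational as ℚ using (ℚ; mkℚ; 0ℚ; 1ℚ; _+_; _*_; -_; _-_; _≤_; *≤*; toℚᵘ; nonNegative; 1/_)
  open import Data.Rational.Properties
  import Data.Rational.Unnormalised as ℚᵘ
  import Data.Rational.Unnormalised.Properties as ℚᵘ
  open import Data.Fin as Fin using (Fin; toℕ; inject₁; fromℕ)
  open import Data.Fin.Relation.Unary.Top using (View; view; ‵fromℕ; ‵inject₁)
  open import Data.Vec as Vec using (Vec; []; _∷_; _∷ʳ_; lookup; zipWith; tabulate; initLast)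
  open import Data.Vec.Properties using (lookup∘tabulate)
  open import Data.Vec.Relation.Unary.All.Properties using (lookup⁺; lookup⁻)
  open import Data.Bool using (if_then_else_)
  open import Data.Product using (_×_; _,_)
  open import Level using (0ℓ)
  open import Relation.Binary.PropositionalEquality
  open import Relation.Nullary using (does)
  open import Relation.Nullary.Decidable using (dec⇒maybe)
  open import Algebra.Properties.Monoid.Sum +-0-monoid using (sum; sum-cong-≗; sum-replicate-zero)
  open import Tactic.RingSolver using (solve-∀)
  open import Tactic.RingSolver.Core.AlmostCommutativeRing using (AlmostCommutativeRing; fromCommutativeRing)
  open import Defs
  open Vectors
  open LatticePoints using (sumℤ; κ; ρ; κ*ρ≡!; sum-ρ; 0≤+*; weighted-sum; FacetInequalities)

  ℚ-ring : AlmostCommutativeRing 0ℓ 0ℓ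
  ℚ-ring = fromCommutativeRing +-*-commutativeRing (λ x → dec⇒maybe (0ℚ ≟ x))

  ⟦⟧≡mkℚ : ∀ z → ⟦ z ⟧ ≡ mkℚ z 0 (coprime-sym (1-coprimeTo ℤ.∣ z ∣))
  ⟦⟧≡mkℚ (+ n)      = normalize-coprime (coprime-sym (1-coprimeTo n))
  ⟦⟧≡mkℚ -[1+ n ]   = cong -_ (normalize-coprime (coprime-sym (1-coprimeTo (suc n))))

  toℚᵘ-⟦⟧ : ∀ z → toℚᵘ ⟦ z ⟧ ≡ ℚᵘ.mkℚᵘ z 0
  toℚᵘ-⟦⟧ z = cong toℚᵘ (⟦⟧≡mkℚ z)

  ⟦⟧-homo-+ : ∀ a b → ⟦ a ℤ.+ b ⟧ ≡ ⟦ a ⟧ + ⟦ b ⟧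
  ⟦⟧-homo-+ a b = toℚᵘ-injective (begin
    toℚᵘ ⟦ a ℤ.+ b ⟧              ≡⟨ toℚᵘ-⟦⟧ (a ℤ.+ b) ⟩
    ℚᵘ.mkℚᵘ (a ℤ.+ b) 0           ≈⟨ ℚᵘ.*≡* (denominators a b) ⟩
    ℚᵘ.mkℚᵘ a 0 ℚᵘ.+ ℚᵘ.mkℚᵘ b 0  ≡⟨ cong₂ ℚᵘ._+_ (toℚᵘ-⟦⟧ a) (toℚᵘ-⟦⟧ b) ⟨
    toℚᵘ ⟦ a ⟧ ℚᵘ.+ toℚᵘ ⟦ b ⟧    ≈⟨ toℚᵘ-homo-+ ⟦ a ⟧ ⟦ b ⟧ ⟨
    toℚᵘ (⟦ a ⟧ + ⟦ b ⟧)          ∎)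
    where
    open ℚᵘ.≃-Reasoning
    denominators : ∀ a b → (a ℤ.+ b) ℤ.* ℤ.+ 1 ≡ (a ℤ.* ℤ.+ 1 ℤ.+ b ℤ.* ℤ.+ 1) ℤ.* ℤ.+ 1
    denominators = ℤ-Solver.solve-∀

  ⟦⟧-homo-* : ∀ a b → ⟦ a ℤ.* b ⟧ ≡ ⟦ a ⟧ * ⟦ b ⟧
  ⟦⟧-homo-* a b = toℚᵘ-injective (begin
    toℚᵘ ⟦ a ℤ.* b ⟧              ≡⟨ toℚᵘ-⟦⟧ (a ℤ.* b) ⟩
    ℚᵘ.mkℚᵘ (a ℤ.* b) 0           ≈⟨ ℚᵘ.*≡* (denominators a b) ⟩
    ℚᵘ.mkℚᵘ a 0 ℚᵘ.* ℚᵘ.mkℚᵘ b 0  ≡⟨ cong₂ ℚᵘ._*_ (toℚᵘ-⟦⟧ a) (toℚᵘ-⟦⟧ b) ⟨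
    toℚᵘ ⟦ a ⟧ ℚᵘ.* toℚᵘ ⟦ b ⟧    ≈⟨ toℚᵘ-homo-* ⟦ a ⟧ ⟦ b ⟧ ⟨
    toℚᵘ (⟦ a ⟧ * ⟦ b ⟧)          ∎)
    where
    open ℚᵘ.≃-Reasoning
    denominators : ∀ a b → (a ℤ.* b) ℤ.* ℤ.+ 1 ≡ (a ℤ.* b) ℤ.* (ℤ.+ 1 ℤ.* ℤ.+ 1)
    denominators = ℤ-Solver.solve-∀

  ⟦⟧-homo‿- : ∀ a → ⟦ ℤ.- a ⟧ ≡ - ⟦ a ⟧
  ⟦⟧-homo‿- a = toℚᵘ-injective (begin
    toℚᵘ ⟦ ℤ.- a ⟧                ≡⟨ toℚᵘ-⟦⟧ (ℤ.- a) ⟩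
    ℚᵘ.- ℚᵘ.mkℚᵘ a 0              ≡⟨ cong ℚᵘ.-_ (toℚᵘ-⟦⟧ a) ⟨
    ℚᵘ.- toℚᵘ ⟦ a ⟧               ≈⟨ toℚᵘ-homo‿- ⟦ a ⟧ ⟨
    toℚᵘ (- ⟦ a ⟧)                ∎)
    where open ℚᵘ.≃-Reasoning

  ⟦⟧-mono-≤ : ∀ {a b} → a ℤ.≤ b → ⟦ a ⟧ ≤ ⟦ b ⟧
  ⟦⟧-mono-≤ {a} {b} a≤b = subst₂ _≤_ (sym (⟦⟧≡mkℚ a)) (sym (⟦⟧≡mkℚ b))
    (*≤* (subst₂ ℤ._≤_ (sym (ℤ.*-identityʳ a)) (sym (ℤ.*-identityʳ b)) a≤b))

  ⟦⟧-cancel-≤ : ∀ {a b} → ⟦ a ⟧ ≤ ⟦ b ⟧ → a ℤ.≤ b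
  ⟦⟧-cancel-≤ {a} {b} ⟦a⟧≤⟦b⟧ with subst₂ _≤_ (⟦⟧≡mkℚ a) (⟦⟧≡mkℚ b) ⟦a⟧≤⟦b⟧
  ... | *≤* a*1≤b*1 = subst₂ ℤ._≤_ (ℤ.*-identityʳ a) (ℤ.*-identityʳ b) a*1≤b*1

  unitEntry : ∀ {n} → Fin n → Fin (suc n) → ℤ
  unitEntry i c = if does (c Fin.≟ inject₁ i) then + 1 else + 0

  unitVector : ∀ n → Fin n → Vec ℤ (suc n)
  unitVector n i = tabulate (unitEntry i)

  apexEntry : ∀ n → Fin n → ℤ
  apexEntry n j = q (suc (toℕ j)) (suc n)

  simplexApex : (n m : ℕ) → Vec ℤ (suc n)
  simplexApex n m = tabulate (apexEntry n) ∷ʳ + (suc n ! ℕ.* m)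

  simplexVertices : (n m : ℕ) → Vec (Vec ℤ (suc n)) (suc (suc n))
  simplexVertices n m = origin (suc n) ∷ (tabulate (unitVector n) ∷ʳ simplexApex n m)

  vertices≡simplexVertices : ∀ n m → vertices (suc n) m ≡ simplexVertices n m
  vertices≡simplexVertices zero    m = cong (λ x → (+ 0 ∷ []) ∷ (+ x ∷ []) ∷ []) (sym (ℕ.+-identityʳ m))
  vertices≡simplexVertices (suc n) m = refl

  q≡-ρ : ∀ n (j : Fin n) → q (suc (toℕ j)) (suc n) ≡ ℤ.- (+ lookup (ρ n) j)
  q≡-ρ n j = cong (λ x → ℤ.- (+ x)) (begin
    suc n ! / κ (toℕ j)                          ≡⟨ cong (_/ κ (toℕ j)) (trans (sym (κ*ρ≡! n j)) (ℕ.*-comm (κ (toℕ j)) _)) ⟩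
    lookup (ρ n) j ℕ.* κ (toℕ j) / κ (toℕ j)     ≡⟨ m*n/n≡m (lookup (ρ n) j) (κ (toℕ j)) ⟩
    lookup (ρ n) j                               ∎)
    where
    open ≡-Reasoning
    instance _ = denom-nonZero (suc (toℕ j))

  combination : ∀ {k d} → Vec ℚ k → Vec (Vec ℤ d) k → Fin d → ℚ
  combination lam V c = sumℚ (zipWith (λ l v → l * ⟦ lookup v c ⟧) lam V)

  combination-∷ʳ : ∀ {k d} (lam : Vec ℚ k) l (V : Vec (Vec ℤ d) k) v c →
                   combination (lam ∷ʳ l) (V ∷ʳ v) c ≡ combination lam V c + l * ⟦ lookup v c ⟧
  combination-∷ʳ lam l V v c =
    trans (cong sumℚ (zipWith-∷ʳ lam V)) (foldr-∷ʳ +-0-monoid (zipWith term lam V) (term l v))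
    where
    term : ℚ → Vec ℤ _ → ℚ
    term l v = l * ⟦ lookup v c ⟧
    zipWith-∷ʳ : ∀ {k} (lam : Vec ℚ k) V → zipWith term (lam ∷ʳ l) (V ∷ʳ v) ≡ zipWith term lam V ∷ʳ term l v
    zipWith-∷ʳ []         []       = refl
    zipWith-∷ʳ (l′ ∷ lam) (v′ ∷ V) = cong (term l′ v′ ∷_) (zipWith-∷ʳ lam V)

  combination-tabulate : ∀ {k d} (ls : Vec ℚ k) (f : Fin k → Vec ℤ d) c →
                         combination ls (tabulate f) c ≡ sum (λ i → lookup ls i * ⟦ lookup (f i) c ⟧)
  combination-tabulate []       f c = refl
  combination-tabulate (l ∷ ls) f c = cong (_+_ (l * ⟦ lookup (f Fin.zero) c ⟧)) (combination-tabulate ls (λ i → f (Fin.suc i)) c)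

  combination-units : ∀ {n} (ls : Vec ℚ n) c → combination ls (tabulate (unitVector n)) c ≡ lookup (ls ∷ʳ 0ℚ) c
  combination-units {n} ls c = trans (combination-tabulate ls (unitVector n) c)
    (trans (sum-cong-≗ (λ i → cong (λ z → lookup ls i * ⟦ z ⟧) (lookup∘tabulate (unitEntry i) c))) (select ls c))
    where
    select : ∀ {n} (ls : Vec ℚ n) c → sum (λ i → lookup ls i * ⟦ unitEntry i c ⟧) ≡ lookup (ls ∷ʳ 0ℚ) c
    select          []       Fin.zero    = refl
    select {suc n} (l ∷ ls) Fin.zero    =
      trans (cong (_+_ (l * 1ℚ)) (trans (sum-cong-≗ (λ i → *-zeroʳ (lookup ls i))) (sum-replicate-zero n)))
            (trans (+-identityʳ (l * 1ℚ)) (*-identityʳ l))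
    select          (l ∷ ls) (Fin.suc c) = trans (cong (_+ rest) (*-zeroʳ l)) (trans (+-identityˡ rest) (select ls c))
      where rest = sum (λ i → lookup ls i * ⟦ unitEntry i c ⟧)

  simplex-combination : ∀ n m l0 (ls : Vec ℚ n) la c →
    combination (l0 ∷ (ls ∷ʳ la)) (simplexVertices n m) c ≡ lookup (ls ∷ʳ 0ℚ) c + la * ⟦ lookup (simplexApex n m) c ⟧
  simplex-combination n m l0 ls la c = begin
    l0 * ⟦ lookup (origin (suc n)) c ⟧ + combination (ls ∷ʳ la) (tabulate (unitVector n) ∷ʳ simplexApex n m) c
      ≡⟨ cong₂ _+_ (trans (cong (λ z → l0 * ⟦ z ⟧) (lookup∘tabulate (λ _ → + 0) c)) (*-zeroʳ l0))
                   (combination-∷ʳ ls la (tabulate (unitVector n)) (simplexApex n m) c) ⟩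
    0ℚ + (combination ls (tabulate (unitVector n)) c + la * ⟦ lookup (simplexApex n m) c ⟧)
      ≡⟨ +-identityˡ _ ⟩
    combination ls (tabulate (unitVector n)) c + la * ⟦ lookup (simplexApex n m) c ⟧
      ≡⟨ cong (_+ la * ⟦ lookup (simplexApex n m) c ⟧) (combination-units ls c) ⟩
    lookup (ls ∷ʳ 0ℚ) c + la * ⟦ lookup (simplexApex n m) c ⟧ ∎
    where open ≡-Reasoning

  simplex-combination-inject₁ : ∀ n m l0 (ls : Vec ℚ n) la j →
    combination (l0 ∷ (ls ∷ʳ la)) (simplexVertices n m) (inject₁ j) ≡ lookup ls j - la * ⟦ + lookup (ρ n) j ⟧
  simplex-combination-inject₁ n m l0 ls la j = begin
    combination (l0 ∷ (ls ∷ʳ la)) (simplexVertices n m) (inject₁ j)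
      ≡⟨ simplex-combination n m l0 ls la (inject₁ j) ⟩
    lookup (ls ∷ʳ 0ℚ) (inject₁ j) + la * ⟦ lookup (simplexApex n m) (inject₁ j) ⟧
      ≡⟨ cong₂ (λ a z → a + la * ⟦ z ⟧) (lookup-∷ʳ-inject₁ ls 0ℚ j) apex-entry ⟩
    lookup ls j + la * ⟦ ℤ.- (+ lookup (ρ n) j) ⟧
      ≡⟨ cong (λ z → lookup ls j + la * z) (⟦⟧-homo‿- (+ lookup (ρ n) j)) ⟩
    lookup ls j + la * - ⟦ + lookup (ρ n) j ⟧
      ≡⟨ cong (_+_ (lookup ls j)) (neg-distribʳ-* la _) ⟨
    lookup ls j - la * ⟦ + lookup (ρ n) j ⟧ ∎
    where
    open ≡-Reasoning
    apex-entry : lookup (simplexApex n m) (inject₁ j) ≡ ℤ.- (+ lookup (ρ n) j)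
    apex-entry = trans (lookup-∷ʳ-inject₁ (tabulate (apexEntry n)) _ j) (trans (lookup∘tabulate (apexEntry n) j) (q≡-ρ n j))

  simplex-combination-fromℕ : ∀ n m l0 (ls : Vec ℚ n) la →
    combination (l0 ∷ (ls ∷ʳ la)) (simplexVertices n m) (fromℕ n) ≡ la * ⟦ + (suc n ! ℕ.* m) ⟧
  simplex-combination-fromℕ n m l0 ls la = begin
    combination (l0 ∷ (ls ∷ʳ la)) (simplexVertices n m) (fromℕ n)
      ≡⟨ simplex-combination n m l0 ls la (fromℕ n) ⟩
    lookup (ls ∷ʳ 0ℚ) (fromℕ n) + la * ⟦ lookup (simplexApex n m) (fromℕ n) ⟧
      ≡⟨ cong₂ (λ a z → a + la * ⟦ z ⟧) (lookup-∷ʳ-fromℕ ls 0ℚ) (lookup-∷ʳ-fromℕ (tabulate (apexEntry n)) (+ (suc n ! ℕ.* m))) ⟩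
    0ℚ + la * ⟦ + (suc n ! ℕ.* m) ⟧
      ≡⟨ +-identityˡ _ ⟩
    la * ⟦ + (suc n ! ℕ.* m) ⟧ ∎
    where open ≡-Reasoning

  0≤⟦+⟧ : ∀ n → 0ℚ ≤ ⟦ + n ⟧
  0≤⟦+⟧ n = ⟦⟧-mono-≤ {+ 0} {+ n} (+≤+ z≤n)

  0≤* : ∀ {p q} → 0ℚ ≤ p → 0ℚ ≤ q → 0ℚ ≤ p * q
  0≤* {p} {q} 0≤p 0≤q = nonNegative⁻¹ (p * q) {{nonNeg*nonNeg⇒nonNeg p {{nonNegative 0≤p}} q {{nonNegative 0≤q}}}}

  ⟦⟧-homo-sum : ∀ {k} (ys : Vec ℤ k) (ls : Vec ℚ k) (es : Vec ℕ k) T la →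
                (∀ j → ⟦ lookup ys j ⟧ ≡ T * (lookup ls j - la * ⟦ + lookup es j ⟧)) →
                ⟦ sumℤ ys ⟧ ≡ T * (sumℚ ls - la * ⟦ + Vec.sum es ⟧)
  ⟦⟧-homo-sum []       []       []       T la _  = sym (ℚ-zero T la)
    where
    ℚ-zero : ∀ T la → T * (0ℚ - la * 0ℚ) ≡ 0ℚ
    ℚ-zero = solve-∀ ℚ-ring
  ⟦⟧-homo-sum (y ∷ ys) (l ∷ ls) (e ∷ es) T la eq = begin
    ⟦ y ℤ.+ sumℤ ys ⟧                                         ≡⟨ ⟦⟧-homo-+ y (sumℤ ys) ⟩
    ⟦ y ⟧ + ⟦ sumℤ ys ⟧                                       ≡⟨ cong₂ _+_ (eq Fin.zero) (⟦⟧-homo-sum ys ls es T la (λ j → eq (Fin.suc j))) ⟩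
    T * (l - la * ⟦ + e ⟧) + T * (sumℚ ls - la * ⟦ + Vec.sum es ⟧) ≡⟨ collect T l la ⟦ + e ⟧ (sumℚ ls) ⟦ + Vec.sum es ⟧ ⟩
    T * (l + sumℚ ls - la * (⟦ + e ⟧ + ⟦ + Vec.sum es ⟧))   ≡⟨ cong (λ z → T * (l + sumℚ ls - la * z)) (⟦⟧-homo-+ (+ e) (+ Vec.sum es)) ⟨
    T * (l + sumℚ ls - la * ⟦ + (e ℕ.+ Vec.sum es) ⟧)       ∎
    where
    open ≡-Reasoning
    collect : ∀ T l la e L E → T * (l - la * e) + T * (L - la * E) ≡ T * (l + L - la * (e + E))
    collect = solve-∀ ℚ-ring

  sumℚ-tabulate : ∀ {k} (w : Fin k → ℤ) D → sumℚ (tabulate (λ j → ⟦ w j ⟧ * D)) ≡ ⟦ sumℤ (tabulate w) ⟧ * D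
  sumℚ-tabulate {zero}  w D = sym (*-zeroˡ D)
  sumℚ-tabulate {suc k} w D = begin
    ⟦ w Fin.zero ⟧ * D + sumℚ (tabulate (λ j → ⟦ w (Fin.suc j) ⟧ * D)) ≡⟨ cong (_+_ (⟦ w Fin.zero ⟧ * D)) (sumℚ-tabulate (λ j → w (Fin.suc j)) D) ⟩
    ⟦ w Fin.zero ⟧ * D + ⟦ sumℤ (tabulate (λ j → w (Fin.suc j))) ⟧ * D ≡⟨ *-distribʳ-+ D ⟦ w Fin.zero ⟧ ⟦ sumℤ (tabulate (λ j → w (Fin.suc j))) ⟧ ⟨
    (⟦ w Fin.zero ⟧ + ⟦ sumℤ (tabulate (λ j → w (Fin.suc j))) ⟧) * D   ≡⟨ cong (_* D) (⟦⟧-homo-+ (w Fin.zero) _) ⟨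
    ⟦ sumℤ (tabulate w) ⟧ * D ∎
    where open ≡-Reasoning

  ⟦⟧-pos-* : ∀ a b → ⟦ + (a ℕ.* b) ⟧ ≡ ⟦ + a ⟧ * ⟦ + b ⟧
  ⟦⟧-pos-* a b = trans (cong ⟦_⟧ (ℤ.pos-* a b)) (⟦⟧-homo-* (+ a) (+ b))

  ⟦!*m⟧≡⟦mκ⟧*⟦ρ⟧ : ∀ n m (j : Fin n) → ⟦ + (suc n ! ℕ.* m) ⟧ ≡ ⟦ + (m ℕ.* κ (toℕ j)) ⟧ * ⟦ + lookup (ρ n) j ⟧
  ⟦!*m⟧≡⟦mκ⟧*⟦ρ⟧ n m j = trans (cong (λ x → ⟦ + x ⟧) !*m≡mκ*ρ) (⟦⟧-pos-* (m ℕ.* κ (toℕ j)) (lookup (ρ n) j))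
    where
    !*m≡mκ*ρ : suc n ! ℕ.* m ≡ m ℕ.* κ (toℕ j) ℕ.* lookup (ρ n) j
    !*m≡mκ*ρ = trans (ℕ.*-comm (suc n !) m) (trans (cong (m ℕ.*_) (sym (κ*ρ≡! n j))) (sym (ℕ.*-assoc m (κ (toℕ j)) _)))

  ⟦!*m⟧≡[⟦Σρ⟧+1]*⟦m⟧ : ∀ n m → ⟦ + (suc n ! ℕ.* m) ⟧ ≡ (⟦ + Vec.sum (ρ n) ⟧ + 1ℚ) * ⟦ + m ⟧
  ⟦!*m⟧≡[⟦Σρ⟧+1]*⟦m⟧ n m = begin
    ⟦ + (suc n ! ℕ.* m) ⟧                  ≡⟨ cong (λ x → ⟦ + (x ℕ.* m) ⟧) (sum-ρ n) ⟨
    ⟦ + ((Vec.sum (ρ n) ℕ.+ 1) ℕ.* m) ⟧    ≡⟨ ⟦⟧-pos-* (Vec.sum (ρ n) ℕ.+ 1) m ⟩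
    ⟦ + (Vec.sum (ρ n) ℕ.+ 1) ⟧ * ⟦ + m ⟧  ≡⟨ cong (_* ⟦ + m ⟧) (⟦⟧-homo-+ (+ Vec.sum (ρ n)) (+ 1)) ⟩
    (⟦ + Vec.sum (ρ n) ⟧ + 1ℚ) * ⟦ + m ⟧   ∎
    where open ≡-Reasoning

  facet-from-coordinates : ∀ c (y kz : ℤ) T l la R →
                           ⟦ y ⟧ ≡ T * (l - la * R) → ⟦ kz ⟧ ≡ T * (la * (⟦ + c ⟧ * R)) →
                           0ℚ ≤ T → 0ℚ ≤ l → ℤ.0ℤ ℤ.≤ + c ℤ.* y ℤ.+ kz
  facet-from-coordinates c y kz T l la R y≡ kz≡ 0≤T 0≤l =
    ⟦⟧-cancel-≤ {ℤ.0ℤ} (subst (0ℚ ≤_) (sym value) (0≤* (0≤* (0≤⟦+⟧ c) 0≤T) 0≤l))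
    where
    cancel : ∀ C T l la R → C * (T * (l - la * R)) + T * (la * (C * R)) ≡ C * T * l
    cancel = solve-∀ ℚ-ring
    value : ⟦ + c ℤ.* y ℤ.+ kz ⟧ ≡ ⟦ + c ⟧ * T * l
    value = begin
      ⟦ + c ℤ.* y ℤ.+ kz ⟧
        ≡⟨ trans (⟦⟧-homo-+ (+ c ℤ.* y) kz) (cong (_+ ⟦ kz ⟧) (⟦⟧-homo-* (+ c) y)) ⟩
      ⟦ + c ⟧ * ⟦ y ⟧ + ⟦ kz ⟧
        ≡⟨ cong₂ (λ a b → ⟦ + c ⟧ * a + b) y≡ kz≡ ⟩
      ⟦ + c ⟧ * (T * (l - la * R)) + T * (la * (⟦ + c ⟧ * R))
        ≡⟨ cancel ⟦ + c ⟧ T l la R ⟩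
      ⟦ + c ⟧ * T * l ∎
      where open ≡-Reasoning

  bound-from-coordinates : ∀ m t (s kz : ℤ) S l0 L la →
                           ⟦ s ⟧ ≡ ⟦ + t ⟧ * (L - la * S) → ⟦ kz ⟧ ≡ ⟦ + t ⟧ * (la * ((S + 1ℚ) * ⟦ + m ⟧)) →
                           l0 + (L + la) ≡ 1ℚ → 0ℚ ≤ l0 → + m ℤ.* s ℤ.+ kz ℤ.≤ + (m ℕ.* t)
  bound-from-coordinates m t s kz S l0 L la s≡ kz≡ sum≡1 0≤l0 =
    ℤ.0≤i-j⇒j≤i (⟦⟧-cancel-≤ {ℤ.0ℤ} (subst (0ℚ ≤_) (sym value) (0≤* (0≤* (0≤⟦+⟧ m) (0≤⟦+⟧ t)) 0≤l0)))
    where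
    M = ⟦ + m ⟧
    T = ⟦ + t ⟧
    regroup : ∀ M T L la S → M * T + - (M * (T * (L - la * S)) + T * (la * ((S + 1ℚ) * M))) ≡ M * T * (1ℚ - (L + la))
    regroup = solve-∀ ℚ-ring
    cancel : ∀ a b → a + b - b ≡ a
    cancel = solve-∀ ℚ-ring
    value : ⟦ + (m ℕ.* t) ℤ.- (+ m ℤ.* s ℤ.+ kz) ⟧ ≡ M * T * l0
    value = begin
      ⟦ + (m ℕ.* t) ℤ.- (+ m ℤ.* s ℤ.+ kz) ⟧
        ≡⟨ trans (⟦⟧-homo-+ (+ (m ℕ.* t)) (ℤ.- (+ m ℤ.* s ℤ.+ kz)))
                 (cong₂ _+_ (⟦⟧-pos-* m t) (⟦⟧-homo‿- (+ m ℤ.* s ℤ.+ kz))) ⟩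
      M * T + - ⟦ + m ℤ.* s ℤ.+ kz ⟧
        ≡⟨ cong (λ x → M * T + - x) (trans (⟦⟧-homo-+ (+ m ℤ.* s) kz) (cong (_+ ⟦ kz ⟧) (⟦⟧-homo-* (+ m) s))) ⟩
      M * T + - (M * ⟦ s ⟧ + ⟦ kz ⟧)
        ≡⟨ cong₂ (λ x y → M * T + - (M * x + y)) s≡ kz≡ ⟩
      M * T + - (M * (T * (L - la * S)) + T * (la * ((S + 1ℚ) * M)))
        ≡⟨ regroup M T L la S ⟩
      M * T * (1ℚ - (L + la))
        ≡⟨ cong (λ x → M * T * (x - (L + la))) sum≡1 ⟨
      M * T * (l0 + (L + la) - (L + la))
        ≡⟨ cong (M * T *_) (cancel l0 (L + la)) ⟩
      M * T * l0 ∎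
      where open ≡-Reasoning

  hull⇒facets : ∀ n m t (ys : Vec ℤ n) kz → InDilatedHull t (simplexVertices n m) (ys ∷ʳ kz) →
                ℤ.0ℤ ℤ.≤ kz × FacetInequalities m t ys kz
  hull⇒facets n m t ys kz (l0 ∷ rest , 0≤lam , sum≡1 , coordinate) with initLast rest
  ... | ls , la , refl = 0≤kz , facet , bound
    where
    T = ⟦ + t ⟧
    N = suc n ! ℕ.* m
    y≡ : ∀ j → ⟦ lookup ys j ⟧ ≡ T * (lookup ls j - la * ⟦ + lookup (ρ n) j ⟧)
    y≡ j = trans (cong ⟦_⟧ (sym (lookup-∷ʳ-inject₁ ys kz j)))
                 (trans (coordinate (inject₁ j)) (cong (T *_) (simplex-combination-inject₁ n m l0 ls la j)))
    kz≡ : ⟦ kz ⟧ ≡ T * (la * ⟦ + N ⟧)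
    kz≡ = trans (cong ⟦_⟧ (sym (lookup-∷ʳ-fromℕ ys kz)))
                (trans (coordinate (fromℕ n)) (cong (T *_) (simplex-combination-fromℕ n m l0 ls la)))
    0≤la : 0ℚ ≤ la
    0≤la = subst (0ℚ ≤_) (lookup-∷ʳ-fromℕ ls la) (lookup⁺ 0≤lam (Fin.suc (fromℕ n)))
    0≤kz : ℤ.0ℤ ℤ.≤ kz
    0≤kz = ⟦⟧-cancel-≤ {ℤ.0ℤ} (subst (0ℚ ≤_) (sym kz≡) (0≤* (0≤⟦+⟧ t) (0≤* 0≤la (0≤⟦+⟧ N))))
    facet : ∀ j → ℤ.0ℤ ℤ.≤ + (m ℕ.* κ (toℕ j)) ℤ.* lookup ys j ℤ.+ kz
    facet j = facet-from-coordinates (m ℕ.* κ (toℕ j)) (lookup ys j) kz T (lookup ls j) la ⟦ + lookup (ρ n) j ⟧ (y≡ j)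
      (trans kz≡ (cong (λ x → T * (la * x)) (⟦!*m⟧≡⟦mκ⟧*⟦ρ⟧ n m j)))
      (0≤⟦+⟧ t) (subst (0ℚ ≤_) (lookup-∷ʳ-inject₁ ls la j) (lookup⁺ 0≤lam (Fin.suc (inject₁ j))))
    bound : + m ℤ.* sumℤ ys ℤ.+ kz ℤ.≤ + (m ℕ.* t)
    bound = bound-from-coordinates m t (sumℤ ys) kz ⟦ + Vec.sum (ρ n) ⟧ l0 (sumℚ ls) la
      (⟦⟧-homo-sum ys ls (ρ n) T la y≡) (trans kz≡ (cong (λ x → T * (la * x)) (⟦!*m⟧≡[⟦Σρ⟧+1]*⟦m⟧ n m)))
      (trans (cong (_+_ l0) (sym (foldr-∷ʳ +-0-monoid ls la))) sum≡1) (lookup⁺ 0≤lam Fin.zero)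

  module Barycentric (n : ℕ) {m t : ℕ} (1≤m : 1 ℕ.≤ m) (1≤t : 1 ℕ.≤ t) (ys : Vec ℤ n) (kz : ℤ) where

    F = suc n !
    N = F ℕ.* m
    T = ⟦ + t ⟧

    instance
      tN≢0 : ℕ.NonZero (t ℕ.* N)
      tN≢0 = ℕ.m*n≢0 t N {{ℕ.>-nonZero 1≤t}} {{ℕ.m*n≢0 F m {{suc n ℕ.!≢0}} {{ℕ.>-nonZero 1≤m}}}}
      ⟦tN⟧>0 : ℚ.Positive ⟦ + (t ℕ.* N) ⟧
      ⟦tN⟧>0 = normalize-pos (t ℕ.* N) 1
      ⟦tN⟧≢0 : ℚ.NonZero ⟦ + (t ℕ.* N) ⟧
      ⟦tN⟧≢0 = pos⇒nonZero ⟦ + (t ℕ.* N) ⟧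

    D : ℚ
    D = 1/ ⟦ + (t ℕ.* N) ⟧

    0≤D : 0ℚ ≤ D
    0≤D = nonNegative⁻¹ D {{pos⇒nonNeg D {{1/pos⇒pos ⟦ + (t ℕ.* N) ⟧}}}}

    ⟦tN⟧*D≡1 : ⟦ + (t ℕ.* N) ⟧ * D ≡ 1ℚ
    ⟦tN⟧*D≡1 = *-inverseʳ ⟦ + (t ℕ.* N) ⟧

    w : Fin n → ℤ
    w j = + lookup (ρ n) j ℤ.* (+ (m ℕ.* κ (toℕ j)) ℤ.* lookup ys j ℤ.+ kz)

    w₀ : ℤ
    w₀ = + F ℤ.* (+ (m ℕ.* t) ℤ.- (+ m ℤ.* sumℤ ys ℤ.+ kz))

    l0 la : ℚ
    l0 = ⟦ w₀ ⟧ * D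
    la = ⟦ kz ⟧ * D

    ls : Vec ℚ n
    ls = tabulate (λ j → ⟦ w j ⟧ * D)

    λs : Vec ℚ (suc (suc n))
    λs = l0 ∷ (ls ∷ʳ la)

    λs-nonneg : ℤ.0ℤ ℤ.≤ kz → FacetInequalities m t ys kz → ∀ i → 0ℚ ≤ lookup λs i
    λs-nonneg _    (_ , bound)     Fin.zero    = 0≤* (⟦⟧-mono-≤ {ℤ.0ℤ} (0≤+* F (ℤ.i≤j⇒0≤j-i bound))) 0≤D
    λs-nonneg 0≤kz (facet , _)     (Fin.suc i) = nonneg-view (view i)
      where
      nonneg-view : ∀ {i} → View i → 0ℚ ≤ lookup (ls ∷ʳ la) i
      nonneg-view ‵fromℕ       = subst (0ℚ ≤_) (sym (lookup-∷ʳ-fromℕ ls la)) (0≤* (⟦⟧-mono-≤ {ℤ.0ℤ} 0≤kz) 0≤D)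
      nonneg-view (‵inject₁ j) =
        subst (0ℚ ≤_) (sym (trans (lookup-∷ʳ-inject₁ ls la j) (lookup∘tabulate (λ j → ⟦ w j ⟧ * D) j)))
              (0≤* (⟦⟧-mono-≤ {ℤ.0ℤ} (0≤+* (lookup (ρ n) j) (facet j))) 0≤D)

    numerators : w₀ ℤ.+ sumℤ (tabulate w) ℤ.+ kz ≡ + (t ℕ.* N)
    numerators = begin
      w₀ ℤ.+ sumℤ (tabulate w) ℤ.+ kz
        ≡⟨ cong (λ x → w₀ ℤ.+ x ℤ.+ kz) (weighted-sum ys (ρ n) (λ j → m ℕ.* κ (toℕ j)) kz mκρ≡m!) ⟩
      + F ℤ.* (+ (m ℕ.* t) ℤ.- (+ m ℤ.* S ℤ.+ kz)) ℤ.+ (+ (m ℕ.* F) ℤ.* S ℤ.+ kz ℤ.* + σ) ℤ.+ kz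
        ≡⟨ cong₂ (λ x y → + F ℤ.* (x ℤ.- (+ m ℤ.* S ℤ.+ kz)) ℤ.+ (y ℤ.* S ℤ.+ kz ℤ.* + σ) ℤ.+ kz) (ℤ.pos-* m t) (ℤ.pos-* m F) ⟩
      + F ℤ.* (+ m ℤ.* + t ℤ.- (+ m ℤ.* S ℤ.+ kz)) ℤ.+ (+ m ℤ.* + F ℤ.* S ℤ.+ kz ℤ.* + σ) ℤ.+ kz
        ≡⟨ telescope (+ F) (+ σ) (+ m) (+ t) S kz (trans (cong +_ (sym (sum-ρ n))) (ℤ.pos-+ σ 1)) ⟩
      + t ℤ.* (+ F ℤ.* + m)
        ≡⟨ trans (ℤ.pos-* t N) (cong (+ t ℤ.*_) (ℤ.pos-* F m)) ⟨
      + (t ℕ.* N) ∎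
      where
      open ≡-Reasoning
      S = sumℤ ys
      σ = Vec.sum (ρ n)
      mκρ≡m! : ∀ j → m ℕ.* κ (toℕ j) ℕ.* lookup (ρ n) j ≡ m ℕ.* F
      mκρ≡m! j = trans (ℕ.*-assoc m (κ (toℕ j)) _) (cong (m ℕ.*_) (κ*ρ≡! n j))
      telescope : ∀ F σ m t S k → F ≡ σ ℤ.+ ℤ.1ℤ →
                  F ℤ.* (m ℤ.* t ℤ.- (m ℤ.* S ℤ.+ k)) ℤ.+ (m ℤ.* F ℤ.* S ℤ.+ k ℤ.* σ) ℤ.+ k ≡ t ℤ.* (F ℤ.* m)
      telescope _ σ m t S k refl = identity σ m t S k
        where
        identity : ∀ σ m t S k →
                   (σ ℤ.+ ℤ.1ℤ) ℤ.* (m ℤ.* t ℤ.- (m ℤ.* S ℤ.+ k)) ℤ.+ (m ℤ.* (σ ℤ.+ ℤ.1ℤ) ℤ.* S ℤ.+ k ℤ.* σ) ℤ.+ k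
                   ≡ t ℤ.* ((σ ℤ.+ ℤ.1ℤ) ℤ.* m)
        identity = ℤ-Solver.solve-∀

    λs-sum : sumℚ λs ≡ 1ℚ
    λs-sum = begin
      l0 + sumℚ (ls ∷ʳ la)                                  ≡⟨ cong (_+_ l0) (foldr-∷ʳ +-0-monoid ls la) ⟩
      l0 + (sumℚ ls + la)                                   ≡⟨ cong (λ x → l0 + (x + la)) (sumℚ-tabulate w D) ⟩
      ⟦ w₀ ⟧ * D + (⟦ sumℤ (tabulate w) ⟧ * D + ⟦ kz ⟧ * D) ≡⟨ factor ⟦ w₀ ⟧ ⟦ sumℤ (tabulate w) ⟧ ⟦ kz ⟧ D ⟩
      (⟦ w₀ ⟧ + ⟦ sumℤ (tabulate w) ⟧ + ⟦ kz ⟧) * D         ≡⟨ cong (_* D) numerators′ ⟨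
      ⟦ + (t ℕ.* N) ⟧ * D                                   ≡⟨ ⟦tN⟧*D≡1 ⟩
      1ℚ                                                    ∎
      where
      open ≡-Reasoning
      factor : ∀ a b c D → a * D + (b * D + c * D) ≡ (a + b + c) * D
      factor = solve-∀ ℚ-ring
      numerators′ : ⟦ + (t ℕ.* N) ⟧ ≡ ⟦ w₀ ⟧ + ⟦ sumℤ (tabulate w) ⟧ + ⟦ kz ⟧
      numerators′ = trans (cong ⟦_⟧ (sym numerators))
                          (trans (⟦⟧-homo-+ (w₀ ℤ.+ sumℤ (tabulate w)) kz) (cong (_+ ⟦ kz ⟧) (⟦⟧-homo-+ w₀ (sumℤ (tabulate w)))))

    λs-coordinate : ∀ c → ⟦ lookup (ys ∷ʳ kz) c ⟧ ≡ T * combination λs (simplexVertices n m) c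
    λs-coordinate c = coordinate-view (view c)
      where
      coordinate-view : ∀ {c} → View c → ⟦ lookup (ys ∷ʳ kz) c ⟧ ≡ T * combination λs (simplexVertices n m) c
      coordinate-view (‵inject₁ j) = begin
        ⟦ lookup (ys ∷ʳ kz) (inject₁ j) ⟧          ≡⟨ cong ⟦_⟧ (lookup-∷ʳ-inject₁ ys kz j) ⟩
        Y                                          ≡⟨ *-identityˡ Y ⟨
        1ℚ * Y                                     ≡⟨ cong (_* Y) (trans (cong (_* D) tN≡) ⟦tN⟧*D≡1) ⟨
        T * (C * R) * D * Y                        ≡⟨ cancel T R C Y ⟦ kz ⟧ D ⟨
        T * (R * (C * Y + ⟦ kz ⟧) * D - la * R)     ≡⟨ cong (λ x → T * (x * D - la * R)) w≡ ⟨
        T * (⟦ w j ⟧ * D - la * R)                  ≡⟨ cong (λ x → T * (x - la * R)) (lookup∘tabulate (λ j → ⟦ w j ⟧ * D) j) ⟨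
        T * (lookup ls j - la * R)                 ≡⟨ cong (T *_) (simplex-combination-inject₁ n m l0 ls la j) ⟨
        T * combination λs (simplexVertices n m) (inject₁ j) ∎
        where
        open ≡-Reasoning
        Y = ⟦ lookup ys j ⟧
        R = ⟦ + lookup (ρ n) j ⟧
        C = ⟦ + (m ℕ.* κ (toℕ j)) ⟧
        cancel : ∀ T R C Y K D → T * (R * (C * Y + K) * D - K * D * R) ≡ T * (C * R) * D * Y
        cancel = solve-∀ ℚ-ring
        w≡ : ⟦ w j ⟧ ≡ R * (C * Y + ⟦ kz ⟧)
        w≡ = trans (⟦⟧-homo-* (+ lookup (ρ n) j) (+ (m ℕ.* κ (toℕ j)) ℤ.* lookup ys j ℤ.+ kz))
                   (cong (R *_) (trans (⟦⟧-homo-+ (+ (m ℕ.* κ (toℕ j)) ℤ.* lookup ys j) kz)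
                                       (cong (_+ ⟦ kz ⟧) (⟦⟧-homo-* (+ (m ℕ.* κ (toℕ j))) (lookup ys j)))))
        tN≡ : T * (C * R) ≡ ⟦ + (t ℕ.* N) ⟧
        tN≡ = sym (trans (⟦⟧-pos-* t N) (cong (T *_) (⟦!*m⟧≡⟦mκ⟧*⟦ρ⟧ n m j)))
      coordinate-view ‵fromℕ = begin
        ⟦ lookup (ys ∷ʳ kz) (fromℕ n) ⟧            ≡⟨ cong ⟦_⟧ (lookup-∷ʳ-fromℕ ys kz) ⟩
        ⟦ kz ⟧                                     ≡⟨ *-identityˡ ⟦ kz ⟧ ⟨
        1ℚ * ⟦ kz ⟧                                ≡⟨ cong (_* ⟦ kz ⟧) (trans (cong (_* D) (sym (⟦⟧-pos-* t N))) ⟦tN⟧*D≡1) ⟨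
        T * ⟦ + N ⟧ * D * ⟦ kz ⟧                   ≡⟨ rearrange T ⟦ + N ⟧ D ⟦ kz ⟧ ⟨
        T * (la * ⟦ + N ⟧)                         ≡⟨ cong (T *_) (simplex-combination-fromℕ n m l0 ls la) ⟨
        T * combination λs (simplexVertices n m) (fromℕ n) ∎
        where
        open ≡-Reasoning
        rearrange : ∀ T N D K → T * (K * D * N) ≡ T * N * D * K
        rearrange = solve-∀ ℚ-ring

  facets⇒hull : ∀ n {m t} → 1 ℕ.≤ m → 1 ℕ.≤ t → (ys : Vec ℤ n) (kz : ℤ) →
                ℤ.0ℤ ℤ.≤ kz → FacetInequalities m t ys kz → InDilatedHull t (simplexVertices n m) (ys ∷ʳ kz)
  facets⇒hull n 1≤m 1≤t ys kz 0≤kz facets = λs , lookup⁻ (λs-nonneg 0≤kz facets) , λs-sum , λs-coordinate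
    where open Barycentric n 1≤m 1≤t ys kz

open import Data.Nat using (ℕ; suc; _+_; _*_; _^_; _≤_; z≤n)
open import Data.Nat.Combinatorics using (_C_)
open import Data.Integer using (ℤ; +_; +≤+; ∣_∣)
open import Data.Integer.Properties using (0≤i⇒+∣i∣≡i; +-injective)
open import Data.Vec using (Vec; _∷ʳ_; initLast)
open import Data.Vec.Properties using (∷ʳ-injective)
open import Data.Product using (_,_; proj₁; proj₂)
open import Function.Definitions using (Injective)
open import Relation.Binary.PropositionalEquality using (_≡_; refl; sym; cong; cong₂; subst)
open import Defs
open Enumerations
open Arithmetic using (ehrhart-arithmetic)
open LatticePoints using (Point; Points; FacetInequalities; points-enumeration)
open ConvexHull using (simplexVertices; vertices≡simplexVertices; hull⇒facets; facets⇒hull)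

embed : ∀ {n} → Point n → Vec ℤ (suc n)
embed (ys , k) = ys ∷ʳ + k

embed-injective : ∀ {n} → Injective _≡_ _≡_ (embed {n})
embed-injective {n} {ys₁ , k₁} {ys₂ , k₂} eq =
  cong₂ _,_ (proj₁ (∷ʳ-injective ys₁ ys₂ eq)) (+-injective (proj₂ (∷ʳ-injective ys₁ ys₂ eq)))

module _ (n : ℕ) {m t : ℕ} (1≤m : 1 ≤ m) (1≤t : 1 ≤ t) where

  to-simplex : ∀ {x} → InDilatedHull t (vertices (suc n) m) x → InDilatedHull t (simplexVertices n m) x
  to-simplex {x} = subst (λ V → InDilatedHull t V x) (vertices≡simplexVertices n m)

  dilate⊆image : ∀ {x} → InDilatedHull t (vertices (suc n) m) x → Image embed (Points m t) x
  dilate⊆image {x} x∈tS with initLast x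
  ... | ys , kz , refl with hull⇒facets n m t ys kz (to-simplex {ys ∷ʳ kz} x∈tS)
  ... | 0≤kz , facets = (ys , ∣ kz ∣) , subst (FacetInequalities m t ys) (sym +∣kz∣≡kz) facets , cong (ys ∷ʳ_) +∣kz∣≡kz
    where +∣kz∣≡kz = 0≤i⇒+∣i∣≡i 0≤kz

  image⊆dilate : ∀ {x} → Image embed (Points m t) x → InDilatedHull t (vertices (suc n) m) x
  image⊆dilate ((ys , k) , facets , refl) =
    subst (λ V → InDilatedHull t V (ys ∷ʳ + k)) (sym (vertices≡simplexVertices n m))
          (facets⇒hull n 1≤m 1≤t ys (+ k) (+≤+ z≤n) facets)

corollary6p10 : (d m : ℕ) → 1 ≤ d → 1 ≤ m → (t : ℕ) → 1 ≤ t →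
    latticeCount≡ d m t (m * t ^ d + Σ< d (λ i → (d C i) * t ^ i))
corollary6p10 (suc n) m _ 1≤m t 1≤t =
  hasExactly (subst (Enumeration _) (ehrhart-arithmetic n 1≤m 1≤t)
    (resp-enumeration (image⊆dilate n 1≤m 1≤t) (dilate⊆image n 1≤m 1≤t)
      (image-enumeration embed-injective (points-enumeration n 1≤m 1≤t))))
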